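{- For each $m\in\mathbb{N}$, there exists a graph $G_m$ of maximum degree at most $3$, tree-cut width at most $2$, and edge-cut width at least $m+1$.
   Context: Graphs are finite and undirected. Edge-cut width: for a graph $G$ and a maximal spanning forest $T$ of $G$, the local feedback edge set at $v\in V(G)$ is $E_{\mathrm{loc}}^{G,T}(v)=\{uw\in E(G)\setminus E(T) : \text{the unique path between } u \text{ and } w \text{ in } T \text{ contains } v\}$. The edge-cut width of $(G,T)$ is $\operatorname{ecw}(G,T)=1+\max_{v\in V(G)}|E_{\mathrm{loc}}^{G,T}(v)|$, and the edge-cut width $\operatorname{ecw}(G)$ is the minimum of $\operatorname{ecw}(G,T)$ over all maximal spanning forests $T$ of $G$. Tree-cut width: a tree-cut decomposition of $G$ is a pair $(T,\mathcal{X})$ of a rooted tree $T$ and a family $\mathcal{X}=\{X_t : t\in V(T)\}$ of pairwise disjoint (possibly empty) subsets of $V(G)$ whose union is $V(G)$ (bags). For a non-root node $t$ with parent $u$, let $T_u,T_t$ be the components of $T-ut$ containing $u$ and $t$; the adhesion $\operatorname{adh}(t)$ is the number of edges of $G$ with one endpoint in $\bigcup_{q\in T_u}X_q$ and the other in $\bigcup_{q\in T_t}X_q$; $\operatorname{adh}(r)=0$ for the root $r$. The torso $H_t$ at $t$ is $G$ if $T$ has one node; otherwise, for the components $T_1,\dots,T_\ell$ of $T-t$, each set $Z_i=\bigcup_{b\in V(T_i)}X_b$ is consolidated into a single vertex $z_i$ (replace $Z_i$ by $z_i$, and for each edge between $Z_i$ and a vertex $v\notin Z_i$ add an edge $z_iv$,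 possibly creating parallel edges). Suppressing a vertex of degree at most $2$ means deleting it and, if it had degree two, adding an edge between its two neighbors. The 3-center $\tilde H_t$ of $(H_t,X_t)$ is obtained by exhaustively suppressing vertices not in $X_t$ of degree at most two; $\operatorname{tor}(t)=|V(\tilde H_t)|$. The width of $(T,\mathcal{X})$ is $\max_{t\in V(T)}\max\{\operatorname{adh}(t),\operatorname{tor}(t)\}$, and the tree-cut width $\operatorname{tcw}(G)$ is the minimum width over all tree-cut decompositions of $G$. -}

module Defs where

open import Data.Nat using (ℕ; zero; suc; _+_; _≤_; _<_)
open import Data.Bool using (Bool; true; false; not; _∨_; _∧_; _xor_; if_then_else_)
open import Data.Fin using (Fin; toℕ; zero; suc)
import Data.Fin as Fin
open import Data.List using (List; []; _∷_; _++_; map; length; filterᵇ; concatMap; head; last; allFin; [_])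
open import Data.Nat.ListAction using (sum)
open import Data.Bool.ListAction using (any)
open import Data.Empty using (⊥)
open import Data.List.Membership.Propositional using (_∈_; _∉_)
open import Data.List.Relation.Unary.All using (All)
open import Data.List.Relation.Unary.Linked using (Linked)
open import Data.List.Relation.Unary.Unique.Propositional using (Unique)
open import Data.Maybe using (Maybe; just; nothing)
open import Data.Product using (Σ; ∃; ∃-syntax; _×_; _,_; proj₁; proj₂)
open import Data.Sum using (_⊎_; inj₁; inj₂)
import Data.Sum.Properties as SumP
open import Relation.Binary.Definitions using (DecidableEquality)
open import Relation.Binary.PropositionalEquality using (_≡_)
open import Relation.Binary.Construct.Closure.ReflexiveTransitive using (Star)
open import Relation.Nullary using (¬_)
open import Relation.Nullary.Decidable using (⌊_⌋)

-- Finite simple undirected graphs.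
-- Vertices are Fin n; each edge {u,w} is stored once as (u , w) with
-- toℕ u < toℕ w; the edge list has no duplicates.

Edge : ℕ → Set
Edge n = Fin n × Fin n

record Graph : Set where
  field
    n       : ℕ
    E       : List (Edge n)
    ordered : All (λ e → toℕ (proj₁ e) < toℕ (proj₂ e)) E
    nodup   : Unique E
open Graph public

_==_ : ∀ {n} → Fin n → Fin n → Bool
x == y = ⌊ x Fin.≟ y ⌋

incidentᵇ : ∀ {n} → Fin n → Edge n → Bool
incidentᵇ v (x , y) = (x == v) ∨ (y == v)

degree : (G : Graph) → Fin (n G) → ℕ
degree G v = length (filterᵇ (incidentᵇ v) (E G))

MaxDegreeAtMost : ℕ → Graph → Set
MaxDegreeAtMost d G = ∀ v → degree G v ≤ d

Adj : ∀ {n} → List (Edge n) → Fin n → Fin n → Set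
Adj F x y = ((x , y) ∈ F) ⊎ ((y , x) ∈ F)

IsCycle : ∀ {n} → List (Edge n) → List (Fin n) → Set
IsCycle F []       = ⊥
IsCycle F (x ∷ xs) = 3 ≤ length (x ∷ xs) × Unique (x ∷ xs) × Linked (Adj F) ((x ∷ xs) ++ [ x ])

Acyclic : ∀ {n} → List (Edge n) → Set
Acyclic {n} F = ∀ (c : List (Fin n)) → ¬ IsCycle F c

IsPath : ∀ {n} → List (Edge n) → Fin n → Fin n → List (Fin n) → Set
IsPath F u w p = Unique p × Linked (Adj F) p × head p ≡ just u × last p ≡ just w

IsMaximalSpanningForest : (G : Graph) → List (Edge (n G)) → Set
IsMaximalSpanningForest G F =
  All (_∈ E G) F × Unique F × Acyclic F ×
  (∀ e → e ∈ E G → e ∉ F → ¬ Acyclic (e ∷ F))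

InLocalFeedback : (G : Graph) → List (Edge (n G)) → Fin (n G) → Edge (n G) → Set
InLocalFeedback G F v (u , w) =
  (u , w) ∈ E G × (u , w) ∉ F × ∃[ p ] (IsPath F u w p × v ∈ p)

-- ecw(G,F) ≥ k : some vertex v has |E_loc(v)| ≥ k - 1, i.e. there is a
-- duplicate-free list L of edges of E_loc(v) with k ≤ 1 + length L
EcwAtLeast : (G : Graph) → List (Edge (n G)) → ℕ → Set
EcwAtLeast G F k = ∃[ v ] ∃[ L ] (Unique L × All (InLocalFeedback G F v) L × k ≤ 1 + length L)

EdgeCutWidthAtLeast : Graph → ℕ → Set
EdgeCutWidthAtLeast G k = ∀ F → IsMaximalSpanningForest G F → EcwAtLeast G F k

-- Exhaustive suppression in a multigraph (vertex list, edge list with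
-- possible parallel edges and loops).

module Suppression {V : Set} (_≟_ : DecidableEquality V) (keep : V → Bool) where

  _=ᵇ_ : V → V → Bool
  x =ᵇ y = ⌊ x ≟ y ⌋

  MState : Set
  MState = List V × List (V × V)

  deg : V → List (V × V) → ℕ
  deg z es = sum (map (λ e → (if proj₁ e =ᵇ z then 1 else 0) + (if proj₂ e =ᵇ z then 1 else 0)) es)

  others : V → List (V × V) → List V
  others z = concatMap (λ e → if (proj₁ e =ᵇ z) ∧ (proj₂ e =ᵇ z) then []
                               else if proj₁ e =ᵇ z then [ proj₂ e ]
                               else if proj₂ e =ᵇ z then [ proj₁ e ]
                               else [])

  removeIncident : V → List (V × V) → List (V × V)
  removeIncident z = filterᵇ (λ e → not ((proj₁ e =ᵇ z) ∨ (proj₂ e =ᵇ z)))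

  -- edge added when suppressing a vertex of degree two (between its two
  -- neighbours); nothing is added for degree ≤ 1 or for a lone loop
  newEdge : List V → List (V × V)
  newEdge (a ∷ b ∷ []) = [ (a , b) ]
  newEdge _            = []

  data Step : MState → MState → Set where
    suppress : ∀ {vs es} z → z ∈ vs → keep z ≡ false → deg z es ≤ 2 →
               Step (vs , es) (filterᵇ (λ x → not (x =ᵇ z)) vs ,
                               newEdge (others z es) ++ removeIncident z es)

  Terminal : MState → Set
  Terminal s = ∀ s' → ¬ Step s s'

  CenterSizeAtMost : MState → ℕ → Set
  CenterSizeAtMost s b = ∀ s' → Star Step s s' → Terminal s' → length (proj₁ s') ≤ b

-- The rooted tree has nodes Fin (suc k), root zero; node suc i has
-- parent (parent i), whose index is smaller (every rooted tree admits
-- such a labelling, e.g. BFS order). Bags are given by bag : V(G) → nodes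
-- (X_t = {v | bag v ≡ t}); this is exactly a partition into disjoint,
-- possibly empty, bags.

record TreeCutDecomposition (G : Graph) : Set where
  field
    k         : ℕ
    parent    : Fin k → Fin (suc k)
    parent-lt : ∀ i → toℕ (parent i) ≤ toℕ i
    bag       : Fin (n G) → Fin (suc k)

module _ {G : Graph} (D : TreeCutDecomposition G) where
  open TreeCutDecomposition D

  Node : Set
  Node = Fin (suc k)

  -- s, parent s, parent (parent s), ..., root  (fuel suc k suffices)
  ancestorsF : ℕ → Node → List Node
  ancestorsF _       zero    = [ zero ]
  ancestorsF zero    (suc i) = [ suc i ]
  ancestorsF (suc f) (suc i) = suc i ∷ ancestorsF f (parent i)

  ancestors : Node → List Node
  ancestors = ancestorsF (suc k)

  inSubtree : Node → Node → Bool
  inSubtree t s = any (_== t) (ancestors s)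

  adhesion : Node → ℕ
  adhesion zero = 0
  adhesion t    = length (filterᵇ (λ e → inSubtree t (bag (proj₁ e)) xor inSubtree t (bag (proj₂ e))) (E G))

  -- the element of the list directly preceding t (the child of t towards s)
  before : Node → List Node → Node
  before t (x ∷ y ∷ rest) = if y == t then x else before t (y ∷ rest)
  before t _              = t

  TVertex : Set
  TVertex = Fin (n G) ⊎ Node

  -- vertex of the torso at t that v of G is mapped to: v itself if v ∈ X_t;
  -- otherwise the consolidated vertex of the component of T - t containing
  -- bag v, labelled by the child c of t if that component is T_c, and by t
  -- itself for the component containing the parent of t
  cls : Node → Fin (n G) → TVertex
  cls t v = if bag v == t then inj₁ v
            else if inSubtree t (bag v) then inj₂ (before t (ancestors (bag v)))
            else inj₂ t

  children : Node → List Node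
  children t = map suc (filterᵇ (λ i → parent i == t) (allFin k))

  torsoVertices : Node → List TVertex
  torsoVertices t = map inj₁ (filterᵇ (λ v → bag v == t) (allFin (n G)))
                 ++ map inj₂ (children t)
                 ++ (if t == zero then [] else [ inj₂ t ])

  eqTV : DecidableEquality TVertex
  eqTV = SumP.≡-dec Fin._≟_ Fin._≟_

  torsoEdges : Node → List (TVertex × TVertex)
  torsoEdges t = filterᵇ (λ e → not ⌊ eqTV (proj₁ e) (proj₂ e) ⌋)
                   (map (λ e → cls t (proj₁ e) , cls t (proj₂ e)) (E G))

  isX : TVertex → Bool
  isX (inj₁ _) = true
  isX (inj₂ _) = false

  TorAtMost : Node → ℕ → Set
  TorAtMost t b = Suppression.CenterSizeAtMost eqTV isX (torsoVertices t , torsoEdges t) b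

  WidthAtMost : ℕ → Set
  WidthAtMost w = ∀ (t : Node) → adhesion t ≤ w × TorAtMost t w

TreeCutWidthAtMost : Graph → ℕ → Set
TreeCutWidthAtMost G w = Σ (TreeCutDecomposition G) (λ D → WidthAtMost D w)

module Submission where

-- G₀ is a single edge between the ports 0 and 1, and G_{d+1} joins two new ports 0 and 1 to the
-- corresponding ports of two disjoint copies of G_d. A port of G_d gains exactly one edge inside
-- G_{d+1}, so all degrees are at most 3.
--
-- Tree-cut width: the root bag holds the two ports and the two subtrees decompose the copies. Then
-- every bag has at most two vertices and every adhesion is at most 2 (the two port edges of a copy),
-- so every consolidated vertex of a torso has degree at most 2 and is suppressed; only the bag remains.
--
-- Edge-cut width: let F be a maximal spanning forest. Its path from 0 to 1 passes through exactly one
-- copy at every level of nesting, down to an innermost F-edge ab, and in F ∖ ab the vertex a stays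
-- connected to the port 0 and b to the port 1 of every copy on the way. At each of the m levels the
-- other copy offers a walk between the ports; as F ∖ ab separates them, some edge of this walk leaves
-- the component of a. That edge is not in F and its tree path runs through ab, so it belongs to the
-- local feedback set of a. The m edges so found lie in different copies, hence are distinct.

open import Defs
open import Level using (0ℓ)
open import Data.Nat using (ℕ; zero; suc; _+_; _≤_; _<_; z≤n; s≤s)
open import Data.Nat.Properties using (+-commutativeSemigroup; ≤-refl; ≤-trans; ≤-reflexive; ≤-pred; <-≤-trans; ≤-<-trans; <-irrefl; <⇒≢; n≤1+n; +-assoc; +-comm; +-suc; +-identityʳ; +-mono-≤; +-monoʳ-≤; +-monoʳ-<; m≤n+m)
open import Algebra.Properties.CommutativeSemigroup +-commutativeSemigroup using (x∙yz≈y∙xz)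
open import Data.Bool using (Bool; true; false; not; _∧_; _xor_; if_then_else_; T; T?)
open import Data.Bool.Properties using (T-≡; ¬-not; not-¬)
open import Data.Bool.ListAction using (any)
open import Data.Empty using (⊥; ⊥-elim)
open import Data.Fin using (Fin; toℕ; zero; suc; _↑ˡ_; _↑ʳ_; splitAt; punchOut)
import Data.Fin as Fin
open import Data.Fin.Properties using (toℕ-↑ˡ; toℕ-↑ʳ; ↑ˡ-injective; ↑ʳ-injective; splitAt-↑ˡ; splitAt-↑ʳ; splitAt⁻¹-↑ˡ; splitAt⁻¹-↑ʳ; suc-injective; toℕ<n; punchOut-injective)
open import Data.List using (List; []; _∷_; _++_; map; length; filter; filterᵇ; concatMap; head; last; allFin; [_])
open import Data.List.Properties using (length-++-comm; ++-assoc; ++-identityʳ; length-filter)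
open import Data.List.Membership.Propositional using (_∈_; _∉_; find; lose)
open import Data.List.Membership.Propositional.Properties using (∈-map⁻; ∈-map⁺; ∈-++⁻; ∈-++⁺ˡ; ∈-++⁺ʳ; ∈-∃++; ∈-filter⁻; ∈-filter⁺; ∈-allFin; ∈-concat⁺′)
open import Data.List.Relation.Unary.Any using (here; there; any?)
open import Data.List.Relation.Unary.All using (All; []; _∷_; lookup; tabulate; universal)
import Data.List.Relation.Unary.All as All
import Data.List.Relation.Unary.All.Properties as All
open import Data.List.Relation.Unary.All.Properties using (¬Any⇒All¬)
open import Data.List.Relation.Unary.AllPairs using ([]; _∷_; allPairs?)
open import Data.List.Relation.Unary.Linked using (Linked; []; [-]; _∷_; linked?)
import Data.List.Relation.Unary.Linked as Linked
import Data.List.Relation.Unary.Linked.Properties as Linked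
open import Data.List.Relation.Unary.Unique.Propositional using (Unique)
import Data.List.Relation.Unary.Unique.Propositional.Properties as Unique
open import Data.Maybe using (just)
import Data.Maybe.Properties as Maybe
open import Data.Product using (∃-syntax; _×_; _,_; proj₁; proj₂)
open import Data.Product.Properties using (≡-dec)
open import Data.Sum using (_⊎_; inj₁; inj₂; [_,_]′)
import Data.Sum as Sum
open import Data.Sum.Properties using (inj₂-injective)
open import Function using (_∘_; id; case_of_; Equivalence)
open import Relation.Binary.Core using (Rel)
open import Relation.Binary.Definitions using (DecidableEquality)
open import Relation.Binary.PropositionalEquality using (_≡_; _≢_; refl; sym; trans; cong; cong₂; subst)
open import Relation.Binary.Construct.Closure.ReflexiveTransitive using (Star; ε; _◅_; _◅◅_; kleisliStar)
import Relation.Binary.Construct.Closure.ReflexiveTransitive as Star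
open import Relation.Nullary using (¬_; Dec; yes; no; ¬?; _×-dec_; _⊎-dec_)
open import Relation.Nullary.Decidable using (⌊_⌋; isYes≗does; dec-true; dec-false; toWitness)

module _ {A : Set} (_≟_ : DecidableEquality A) where

  ⌊≟⌋-refl : ∀ x → ⌊ x ≟ x ⌋ ≡ true
  ⌊≟⌋-refl x = trans (isYes≗does (x ≟ x)) (dec-true (x ≟ x) refl)

  ⌊≟⌋-≢ : ∀ {x y} → x ≢ y → ⌊ x ≟ y ⌋ ≡ false
  ⌊≟⌋-≢ {x} {y} x≢y = trans (isYes≗does (x ≟ y)) (dec-false (x ≟ y) x≢y)

  ⌊≟⌋⇒≡ : ∀ {x y} → ⌊ x ≟ y ⌋ ≡ true → x ≡ y
  ⌊≟⌋⇒≡ {x} {y} eq = toWitness (Equivalence.from T-≡ eq)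

==-refl : ∀ {n} (x : Fin n) → (x == x) ≡ true
==-refl = ⌊≟⌋-refl Fin._≟_

==-≢ : ∀ {n} {x y : Fin n} → x ≢ y → (x == y) ≡ false
==-≢ = ⌊≟⌋-≢ Fin._≟_

==⇒≡ : ∀ {n} {x y : Fin n} → (x == y) ≡ true → x ≡ y
==⇒≡ = ⌊≟⌋⇒≡ Fin._≟_

==-false⇒≢ : ∀ {n} {x y : Fin n} → (x == y) ≡ false → x ≢ y
==-false⇒≢ {x = x} x=y refl = case trans (sym x=y) (==-refl x) of λ ()

==-∘-injective : ∀ {m n} (f : Fin m → Fin n) → (∀ {a b} → f a ≡ f b → a ≡ b) → ∀ a b → (f a == f b) ≡ (a == b)
==-∘-injective f f-inj a b with a Fin.≟ b
... | yes refl = ==-refl (f a)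
... | no a≢b   = ==-≢ (a≢b ∘ f-inj)

true⇔true⇒≡ : ∀ {a b : Bool} → (a ≡ true → b ≡ true) → (b ≡ true → a ≡ true) → a ≡ b
true⇔true⇒≡ {true}  {true}  _ _ = refl
true⇔true⇒≡ {true}  {false} a⇒b _ = sym (a⇒b refl)
true⇔true⇒≡ {false} {true}  _ b⇒a = b⇒a refl
true⇔true⇒≡ {false} {false} _ _ = refl

⌊⌋≡not-xor : ∀ {A : Set} (a? : Dec A) {x b : Bool} → (A → x ≡ b) → (x ≡ b → A) → ⌊ a? ⌋ ≡ not (x xor b)
⌊⌋≡not-xor (yes a) {x} to _ with to a
... | refl with x
...   | true  = refl
...   | false = refl
⌊⌋≡not-xor (no ¬a) {true}  {true}  _ from = ⊥-elim (¬a (from refl))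
⌊⌋≡not-xor (no ¬a) {true}  {false} _ _    = refl
⌊⌋≡not-xor (no ¬a) {false} {true}  _ _    = refl
⌊⌋≡not-xor (no ¬a) {false} {false} _ from = ⊥-elim (¬a (from refl))

indicator : Bool → ℕ
indicator b = if b then 1 else 0

count : ∀ {A : Set} → (A → Bool) → List A → ℕ
count p xs = length (filterᵇ p xs)

count-∷ : ∀ {A : Set} (p : A → Bool) x xs → count p (x ∷ xs) ≡ indicator (p x) + count p xs
count-∷ p x xs with p x
... | true  = refl
... | false = refl

count-++ : ∀ {A : Set} (p : A → Bool) xs ys → count p (xs ++ ys) ≡ count p xs + count p ys
count-++ p []       ys = refl
count-++ p (x ∷ xs) ys
  rewrite count-∷ p x (xs ++ ys) | count-∷ p x xs | count-++ p xs ys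
  = sym (+-assoc (indicator (p x)) _ _)

count-map : ∀ {A B : Set} (p : B → Bool) (f : A → B) xs → count p (map f xs) ≡ count (p ∘ f) xs
count-map p f []       = refl
count-map p f (x ∷ xs) rewrite count-∷ p (f x) (map f xs) | count-∷ (p ∘ f) x xs | count-map p f xs = refl

count-cong : ∀ {A : Set} {p q : A → Bool} → (∀ x → p x ≡ q x) → ∀ xs → count p xs ≡ count q xs
count-cong p≗q []       = refl
count-cong {p = p} {q} p≗q (x ∷ xs) rewrite count-∷ p x xs | count-∷ q x xs | p≗q x | count-cong p≗q xs = refl

count-none : ∀ {A : Set} {p : A → Bool} → (∀ x → p x ≡ false) → ∀ xs → count p xs ≡ 0
count-none p≗false []       = refl
count-none {p = p} p≗false (x ∷ xs) rewrite count-∷ p x xs | p≗false x = count-none p≗false xs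

module _ {V : Set} (_≟_ : DecidableEquality V) (keep : V → Bool) where
  open Suppression _≟_ keep

  multiplicity : V → List V → ℕ
  multiplicity y = count (_=ᵇ y)

  deg-++ : ∀ y xs ys → deg y (xs ++ ys) ≡ deg y xs + deg y ys
  deg-++ y []       ys = refl
  deg-++ y (e ∷ xs) ys rewrite deg-++ y xs ys = sym (+-assoc (indicator (proj₁ e =ᵇ y) + indicator (proj₂ e =ᵇ y)) _ _)

  -- the edges at y that run to z reappear as occurrences of y among the neighbours of z
  deg-removeIncident : ∀ y z es → y ≢ z → deg y es ≡ deg y (removeIncident z es) + multiplicity y (others z es)
  deg-removeIncident y z []             y≢z = refl
  deg-removeIncident y z ((p , q) ∷ es) y≢z with p =ᵇ z in p=z | q =ᵇ z in q=z
  ... | true | true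
      rewrite ⌊≟⌋⇒≡ _≟_ p=z | ⌊≟⌋⇒≡ _≟_ q=z | ⌊≟⌋-≢ _≟_ (y≢z ∘ sym) = deg-removeIncident y z es y≢z
  ... | true | false
      rewrite ⌊≟⌋⇒≡ _≟_ p=z | ⌊≟⌋-≢ _≟_ (y≢z ∘ sym) | count-∷ (_=ᵇ y) q (others z es) | deg-removeIncident y z es y≢z
      = x∙yz≈y∙xz (indicator (q =ᵇ y)) (deg y (removeIncident z es)) _
  ... | false | true
      rewrite ⌊≟⌋⇒≡ _≟_ q=z | ⌊≟⌋-≢ _≟_ (y≢z ∘ sym) | count-∷ (_=ᵇ y) p (others z es) | deg-removeIncident y z es y≢z
            | +-identityʳ (indicator (p =ᵇ y))
      = x∙yz≈y∙xz (indicator (p =ᵇ y)) (deg y (removeIncident z es)) _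
  ... | false | false
      rewrite deg-removeIncident y z es y≢z = sym (+-assoc (indicator (p =ᵇ y) + indicator (q =ᵇ y)) _ _)

  deg-newEdge : ∀ y xs → deg y (newEdge xs) ≤ multiplicity y xs
  deg-newEdge y []               = z≤n
  deg-newEdge y (a ∷ [])         = z≤n
  deg-newEdge y (a ∷ b ∷ [])     rewrite count-∷ (_=ᵇ y) a [ b ] | count-∷ (_=ᵇ y) b [] = ≤-reflexive (+-assoc (indicator (a =ᵇ y)) _ 0)
  deg-newEdge y (a ∷ b ∷ _ ∷ _) = z≤n

  deg-suppress : ∀ y z es → y ≢ z → deg y (newEdge (others z es) ++ removeIncident z es) ≤ deg y es
  deg-suppress y z es y≢z rewrite deg-++ y (newEdge (others z es)) (removeIncident z es) | deg-removeIncident y z es y≢z =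
    ≤-trans (+-mono-≤ (deg-newEdge y (others z es)) ≤-refl) (≤-reflexive (+-comm (multiplicity y (others z es)) _))

  deg-filter-map≤count : ∀ {X : Set} y (q : V × V → Bool) (f : X → V × V) (r : X → Bool) xs →
    (∀ x → q (f x) ≡ true → indicator (proj₁ (f x) =ᵇ y) + indicator (proj₂ (f x) =ᵇ y) ≤ indicator (r x)) →
    deg y (filterᵇ q (map f xs)) ≤ count r xs
  deg-filter-map≤count y q f r []       bound = z≤n
  deg-filter-map≤count y q f r (x ∷ xs) bound with q (f x) in qx
  ... | true  rewrite count-∷ r x xs = +-mono-≤ (bound x qx) (deg-filter-map≤count y q f r xs bound)
  ... | false rewrite count-∷ r x xs = ≤-trans (deg-filter-map≤count y q f r xs bound) (m≤n+m _ _)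

  LowDegree : MState → Set
  LowDegree (vs , es) = ∀ x → x ∈ vs → keep x ≡ false → deg x es ≤ 2

  ∈-filter-≢ : ∀ {x z} vs → x ∈ filterᵇ (λ w → not (w =ᵇ z)) vs → x ∈ vs × x ≢ z
  ∈-filter-≢ {x} {z} vs x∈ with x∈vs , x-kept ← ∈-filter⁻ (T? ∘ λ w → not (w =ᵇ z)) {xs = vs} x∈ =
    x∈vs , λ { refl → subst (T ∘ not) (⌊≟⌋-refl _≟_ x) x-kept }

  LowDegree-step : ∀ {s s'} → Step s s' → LowDegree s → LowDegree s'
  LowDegree-step (suppress {vs} {es} z _ _ _) low x x∈ kx =
    let (x∈vs , x≢z) = ∈-filter-≢ vs x∈ in ≤-trans (deg-suppress x z es x≢z) (low x x∈vs kx)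

  count-filter≤ : ∀ (q : V → Bool) vs → count keep (filterᵇ q vs) ≤ count keep vs
  count-filter≤ q []       = z≤n
  count-filter≤ q (v ∷ vs) with q v
  ... | true  rewrite count-∷ keep v (filterᵇ q vs) | count-∷ keep v vs = +-monoʳ-≤ (indicator (keep v)) (count-filter≤ q vs)
  ... | false rewrite count-∷ keep v vs = ≤-trans (count-filter≤ q vs) (m≤n+m _ (indicator (keep v)))

  kept-step : ∀ {s s'} → Step s s' → count keep (proj₁ s') ≤ count keep (proj₁ s)
  kept-step (suppress {vs} _ _ _ _) = count-filter≤ _ vs

  LowDegree-star : ∀ {s s'} → Star Step s s' → LowDegree s → LowDegree s' × count keep (proj₁ s') ≤ count keep (proj₁ s)
  LowDegree-star ε low = low , ≤-refl
  LowDegree-star (step ◅ steps) low =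
    let (low' , kept≤) = LowDegree-star steps (LowDegree-step step low)
    in low' , ≤-trans kept≤ (kept-step step)

  terminal⇒all-kept : ∀ {s} → LowDegree s → Terminal s → ∀ ws → (∀ x → x ∈ ws → x ∈ proj₁ s) → length ws ≤ count keep ws
  terminal⇒all-kept low term []       ws⊆ = z≤n
  terminal⇒all-kept {s} low term (w ∷ ws) ws⊆ with keep w in kw
  ... | true  = s≤s (terminal⇒all-kept low term ws (λ x x∈ → ws⊆ x (there x∈)))
  ... | false = ⊥-elim (term _ (suppress w w∈ kw (low w w∈ kw)))
    where
    w∈ : w ∈ proj₁ s
    w∈ = ws⊆ w (here refl)

  -- suppression preserves LowDegree, so in a terminal state no suppressible vertex is left
  centerSize≤kept : ∀ s → LowDegree s → CenterSizeAtMost s (count keep (proj₁ s))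
  centerSize≤kept s low s' steps term =
    let (low' , kept≤) = LowDegree-star steps low
    in ≤-trans (terminal⇒all-kept low' term (proj₁ s') (λ x x∈ → x∈)) kept≤

module TreeCut {G : Graph} (D : TreeCutDecomposition G) where
  open TreeCutDecomposition D

  data Desc (t : Node D) : Node D → Set where
    here : Desc t t
    up   : ∀ {i} → Desc t (parent i) → Desc t (suc i)

  parent<suc : ∀ i → toℕ (parent i) < toℕ (Fin.suc i)
  parent<suc i = s≤s (parent-lt i)

  Desc⇒≤ : ∀ {t s} → Desc t s → toℕ t ≤ toℕ s
  Desc⇒≤ here          = ≤-refl
  Desc⇒≤ (up {i} t⊑s) = ≤-trans (Desc⇒≤ t⊑s) (≤-trans (parent-lt i) (n≤1+n (toℕ i)))

  Desc-root : ∀ s → Desc zero s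
  Desc-root s = go (suc k) s (toℕ<n s)
    where
    go : ∀ fuel s → toℕ s < fuel → Desc zero s
    go fuel       zero    _           = here
    go (suc fuel) (suc i) (s≤s i<fuel) = up (go fuel (parent i) (≤-<-trans (parent-lt i) i<fuel))

  Desc-of-root : ∀ {t} → Desc t zero → t ≡ zero
  Desc-of-root here = refl

  Desc-parent : ∀ {i s} → Desc (suc i) s → Desc (parent i) s
  Desc-parent here        = up here
  Desc-parent (up i⊑s) = up (Desc-parent i⊑s)

  Desc-via-child : ∀ {t s} → Desc t s → s ≢ t → ∃[ i ] (parent i ≡ t × Desc (suc i) s)
  Desc-via-child here         s≢t = ⊥-elim (s≢t refl)
  Desc-via-child {t} (up {j} t⊑pj) s≢t with parent j Fin.≟ t
  ... | yes pj≡t = j , pj≡t , here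
  ... | no pj≢t  = let (i , pi≡t , i⊑pj) = Desc-via-child t⊑pj pj≢t in i , pi≡t , up i⊑pj

  Desc-suc⇒≢parent : ∀ {i s} → Desc (suc i) s → s ≢ parent i
  Desc-suc⇒≢parent i⊑s s≡pi = <-irrefl (cong toℕ (sym s≡pi)) (<-≤-trans (parent<suc _) (Desc⇒≤ i⊑s))

  ancestorsF-head : ∀ fuel s → toℕ s < fuel → ∃[ rest ] (ancestorsF D fuel s ≡ s ∷ rest)
  ancestorsF-head fuel       zero    _ = [] , refl
  ancestorsF-head (suc fuel) (suc i) _ = _ , refl

  any-ancestorsF⇒Desc : ∀ fuel s t → toℕ s < fuel → any (_== t) (ancestorsF D fuel s) ≡ true → Desc t s
  any-ancestorsF⇒Desc fuel zero t _ found with zero Fin.≟ t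
  ... | yes refl = here
  any-ancestorsF⇒Desc fuel zero t _ () | no _
  any-ancestorsF⇒Desc (suc fuel) (suc i) t (s≤s i<fuel) found with suc i Fin.≟ t
  ... | yes refl = here
  ... | no _     = up (any-ancestorsF⇒Desc fuel (parent i) t (≤-<-trans (parent-lt i) i<fuel) found)

  Desc⇒any-ancestorsF : ∀ fuel s t → toℕ s < fuel → Desc t s → any (_== t) (ancestorsF D fuel s) ≡ true
  Desc⇒any-ancestorsF fuel zero t _ t⊑0 rewrite Desc-of-root t⊑0 = refl
  Desc⇒any-ancestorsF (suc fuel) (suc i) .(suc i) _ here rewrite ==-refl (suc i) = refl
  Desc⇒any-ancestorsF (suc fuel) (suc i) t (s≤s i<fuel) (up t⊑pi) with suc i == t
  ... | true  = refl
  ... | false = Desc⇒any-ancestorsF fuel (parent i) t (≤-<-trans (parent-lt i) i<fuel) t⊑pi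

  inSubtree⇒Desc : ∀ t s → inSubtree D t s ≡ true → Desc t s
  inSubtree⇒Desc t s = any-ancestorsF⇒Desc (suc k) s t (toℕ<n s)

  Desc⇒inSubtree : ∀ t s → Desc t s → inSubtree D t s ≡ true
  Desc⇒inSubtree t s = Desc⇒any-ancestorsF (suc k) s t (toℕ<n s)

  ∈⇒any-== : ∀ {c : Node D} l → c ∈ l → any (_== c) l ≡ true
  ∈⇒any-== (x ∷ l) (here refl) rewrite ==-refl x = refl
  ∈⇒any-== {c} (x ∷ l) (there c∈l) with x == c
  ... | true  = refl
  ... | false = ∈⇒any-== l c∈l

  before-child : ∀ fuel s i → toℕ s < fuel → Desc (suc i) s → before D (parent i) (ancestorsF D fuel s) ≡ suc i
  before-child (suc fuel) (suc i) .i (s≤s i<fuel) here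
    with rest , eq ← ancestorsF-head fuel (parent i) (≤-<-trans (parent-lt i) i<fuel)
    rewrite eq | ==-refl (parent i) = refl
  before-child (suc fuel) (suc j) i (s≤s j<fuel) (up i⊑pj)
    with rest , eq ← ancestorsF-head fuel (parent j) (≤-<-trans (parent-lt j) j<fuel)
    rewrite eq | ==-≢ (Desc-suc⇒≢parent i⊑pj) | sym eq
    = before-child fuel (parent j) i (≤-<-trans (parent-lt j) j<fuel) i⊑pj

  before-∈ : ∀ t l → before D t l ≡ t ⊎ before D t l ∈ l
  before-∈ t []            = inj₁ refl
  before-∈ t (x ∷ [])      = inj₁ refl
  before-∈ t (x ∷ y ∷ rest) with y == t | before-∈ t (y ∷ rest)
  ... | true  | _             = inj₂ (here refl)
  ... | false | inj₁ b≡t     = inj₁ b≡t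
  ... | false | inj₂ b∈rest  = inj₂ (there b∈rest)

  cls≡child⇒inSubtree : ∀ i v → cls D (parent i) v ≡ inj₂ (suc i) → inSubtree D (suc i) (bag v) ≡ true
  cls≡child⇒inSubtree i v cls≡ with bag v == parent i | inSubtree D (parent i) (bag v)
  cls≡child⇒inSubtree i v () | true | _
  ... | false | true with before-∈ (parent i) (ancestors D (bag v))
  ...   | inj₁ b≡pi  = ⊥-elim (<⇒≢ (parent<suc i) (cong toℕ (trans (sym b≡pi) (inj₂-injective cls≡))))
  ...   | inj₂ b∈anc = subst (λ c → any (_== c) (ancestors D (bag v)) ≡ true) (inj₂-injective cls≡) (∈⇒any-== _ b∈anc)
  cls≡child⇒inSubtree i v cls≡ | false | false = ⊥-elim (<⇒≢ (parent<suc i) (cong toℕ (inj₂-injective cls≡)))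

  inSubtree⇒cls≡child : ∀ i v → inSubtree D (suc i) (bag v) ≡ true → cls D (parent i) v ≡ inj₂ (suc i)
  inSubtree⇒cls≡child i v inside
    rewrite ==-≢ {x = bag v} {y = parent i} (Desc-suc⇒≢parent (inSubtree⇒Desc _ _ inside))
          | Desc⇒inSubtree (parent i) (bag v) (Desc-parent (inSubtree⇒Desc _ _ inside))
          | before-child (suc k) (bag v) i (toℕ<n (bag v)) (inSubtree⇒Desc _ _ inside) = refl

  cls≡self⇒outside : ∀ t v → cls D t v ≡ inj₂ t → inSubtree D t (bag v) ≡ false
  cls≡self⇒outside t v cls≡ with bag v == t in bv=t | inSubtree D t (bag v) in inside
  cls≡self⇒outside t v () | true | _
  ... | false | false = refl
  ... | false | true
    with i , refl , i⊑bv ← Desc-via-child (inSubtree⇒Desc t (bag v) inside) (==-false⇒≢ bv=t)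
    rewrite before-child (suc k) (bag v) i (toℕ<n (bag v)) i⊑bv
    = ⊥-elim (<⇒≢ (parent<suc i) (cong toℕ (sym (inj₂-injective cls≡))))

  outside⇒cls≡self : ∀ t v → inSubtree D t (bag v) ≡ false → cls D t v ≡ inj₂ t
  outside⇒cls≡self t v outside with bag v == t in bv=t
  ... | true  = case trans (sym (Desc⇒inSubtree t (bag v) (subst (Desc t) (sym (==⇒≡ bv=t)) here))) outside of λ ()
  ... | false rewrite outside = refl

  crosses : Node D → Edge (n G) → Bool
  crosses t (u , w) = inSubtree D t (bag u) xor inSubtree D t (bag w)

  crossing : Node D → ℕ
  crossing t = count (crosses t) (E G)

  crossing-root : crossing zero ≡ 0
  crossing-root = count-none nothing-crosses (E G)
    where
    nothing-crosses : ∀ e → crosses zero e ≡ false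
    nothing-crosses (u , w)
      rewrite Desc⇒inSubtree zero (bag u) (Desc-root (bag u)) | Desc⇒inSubtree zero (bag w) (Desc-root (bag w)) = refl

  adhesion≡crossing : ∀ t → adhesion D t ≡ crossing t
  adhesion≡crossing zero    = sym crossing-root
  adhesion≡crossing (suc i) = refl

  open Suppression (eqTV D) (isX D) using (deg; _=ᵇ_)

  -- an edge that is not a loop meets z at most once, and only if it crosses the cut
  endpoint-count≤crosses : ∀ (α β x y b : Bool) → α ∧ β ≡ false → α ≡ not (x xor b) → β ≡ not (y xor b) →
                           indicator α + indicator β ≤ indicator (x xor y)
  endpoint-count≤crosses _ _ true  true  true  () refl refl
  endpoint-count≤crosses _ _ true  true  false _  refl refl = z≤n
  endpoint-count≤crosses _ _ true  false true  _  refl refl = s≤s z≤n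
  endpoint-count≤crosses _ _ true  false false _  refl refl = s≤s z≤n
  endpoint-count≤crosses _ _ false true  true  _  refl refl = s≤s z≤n
  endpoint-count≤crosses _ _ false true  false _  refl refl = s≤s z≤n
  endpoint-count≤crosses _ _ false false true  _  refl refl = z≤n
  endpoint-count≤crosses _ _ false false false () refl refl

  deg-consolidated≤crossing : ∀ t z (b : Bool) →
    (∀ v → cls D t v ≡ inj₂ z → inSubtree D z (bag v) ≡ b) →
    (∀ v → inSubtree D z (bag v) ≡ b → cls D t v ≡ inj₂ z) →
    deg (inj₂ z) (torsoEdges D t) ≤ crossing z
  deg-consolidated≤crossing t z b to from =
    deg-filter-map≤count (eqTV D) (isX D) (inj₂ z) _ (λ e → cls D t (proj₁ e) , cls D t (proj₂ e)) (crosses z) (E G) bound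
    where
    bound : ∀ e → not ⌊ eqTV D (cls D t (proj₁ e)) (cls D t (proj₂ e)) ⌋ ≡ true →
            indicator (cls D t (proj₁ e) =ᵇ inj₂ z) + indicator (cls D t (proj₂ e) =ᵇ inj₂ z) ≤ indicator (crosses z e)
    bound (u , w) not-loop =
      endpoint-count≤crosses _ _ (inSubtree D z (bag u)) (inSubtree D z (bag w)) b not-both
        (⌊⌋≡not-xor (eqTV D (cls D t u) (inj₂ z)) (to u) (from u))
        (⌊⌋≡not-xor (eqTV D (cls D t w) (inj₂ z)) (to w) (from w))
      where
      not-both : (cls D t u =ᵇ inj₂ z) ∧ (cls D t w =ᵇ inj₂ z) ≡ false
      not-both with cls D t u =ᵇ inj₂ z in u=z | cls D t w =ᵇ inj₂ z in w=z
      ... | false | _    = refl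
      ... | true  | false = refl
      ... | true  | true
        rewrite ⌊≟⌋⇒≡ (eqTV D) u=z | ⌊≟⌋⇒≡ (eqTV D) w=z | ⌊≟⌋-refl (eqTV D) (inj₂ z) = case not-loop of λ ()

  bagSize : Node D → ℕ
  bagSize t = count (λ v → bag v == t) (allFin (n G))

  ∈-children⁻ : ∀ {t z} → z ∈ children D t → ∃[ i ] (z ≡ suc i × parent i ≡ t)
  ∈-children⁻ {t} z∈ with i , i∈ , refl ← ∈-map⁻ suc z∈ =
    i , refl , ==⇒≡ (Equivalence.to T-≡ (proj₂ (∈-filter⁻ (λ j → T? (parent j == t)) {xs = allFin k} i∈)))

  ∈-parentSide⁻ : ∀ {t z : Node D} → inj₂ {A = Fin (n G)} z ∈ (if t == zero then [] else [ inj₂ t ]) → z ≡ t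
  ∈-parentSide⁻ {t} z∈ with t == zero
  ∈-parentSide⁻ (here refl) | false = refl

  torso-LowDegree : (∀ t → crossing t ≤ 2) → ∀ t → LowDegree (eqTV D) (isX D) (torsoVertices D t , torsoEdges D t)
  torso-LowDegree cross≤2 t (inj₁ x) _ ()
  torso-LowDegree cross≤2 t (inj₂ z) z∈ _ with ∈-++⁻ (map inj₁ (filterᵇ (λ v → bag v == t) (allFin (n G)))) z∈
  ... | inj₁ z∈X with _ , _ , () ← ∈-map⁻ inj₁ z∈X
  ... | inj₂ z∈rest with ∈-++⁻ (map inj₂ (children D t)) z∈rest
  ...   | inj₁ z∈ch with z' , z'∈ , refl ← ∈-map⁻ inj₂ z∈ch with i , refl , refl ← ∈-children⁻ z'∈ =
    ≤-trans (deg-consolidated≤crossing (parent i) (suc i) true (cls≡child⇒inSubtree i) (inSubtree⇒cls≡child i)) (cross≤2 (suc i))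
  ...   | inj₂ z∈top with refl ← ∈-parentSide⁻ {t} z∈top =
    ≤-trans (deg-consolidated≤crossing t t false (cls≡self⇒outside t) (outside⇒cls≡self t)) (cross≤2 t)

  kept-torsoVertices≤bagSize : ∀ t → count (isX D) (torsoVertices D t) ≤ bagSize t
  kept-torsoVertices≤bagSize t = kept≤ (filterᵇ (λ v → bag v == t) (allFin (n G))) (children D t) (t == zero)
    where
    kept≤ : ∀ X ys b → count (isX D) (map inj₁ X ++ map inj₂ ys ++ (if b then [] else [ inj₂ t ])) ≤ length X
    kept≤ X ys b
      rewrite count-++ (isX D) (map inj₁ X) (map inj₂ ys ++ (if b then [] else [ inj₂ t ]))
            | count-++ (isX D) (map inj₂ ys) (if b then [] else [ inj₂ t ])
            | count-map (isX D) inj₁ X | count-map (isX D) inj₂ ys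
            | count-none {p = isX D ∘ inj₂} (λ _ → refl) ys
      with b
    ... | true  rewrite +-identityʳ (count (isX D ∘ inj₁) X) = length-filter (T? ∘ (isX D ∘ inj₁)) X
    ... | false rewrite +-identityʳ (count (isX D ∘ inj₁) X) = length-filter (T? ∘ (isX D ∘ inj₁)) X

  width≤ : ∀ {w} → 2 ≤ w → (∀ t → bagSize t ≤ w) → (∀ t → crossing t ≤ 2) → WidthAtMost D w
  width≤ 2≤w bag≤w cross≤2 t =
    subst (_≤ _) (sym (adhesion≡crossing t)) (≤-trans (cross≤2 t) 2≤w) ,
    λ s' steps term → ≤-trans (centerSize≤kept (eqTV D) (isX D) _ (torso-LowDegree cross≤2 t) s' steps term)
                              (≤-trans (kept-torsoVertices≤bagSize t) (bag≤w t))

module _ {A : Set} where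

  last-∈ : ∀ (l : List A) {x} → last l ≡ just x → x ∈ l
  last-∈ (z ∷ [])     refl = here refl
  last-∈ (z ∷ z' ∷ l) lt   = there (last-∈ (z' ∷ l) lt)

  head-∈ : ∀ (l : List A) {x} → head l ≡ just x → x ∈ l
  head-∈ (z ∷ l) refl = here refl

  last-++ : ∀ (l m : List A) {y} → last m ≡ just y → last (l ++ m) ≡ just y
  last-++ []           m            lt = lt
  last-++ (x ∷ [])     (z ∷ m)      lt = lt
  last-++ (x ∷ x' ∷ l) m            lt = last-++ (x' ∷ l) m lt

  head-++ : ∀ (l m : List A) {y} → head l ≡ just y → head (l ++ m) ≡ just y
  head-++ (x ∷ l) m hd = hd

  last-snoc : ∀ (l : List A) y → last (l ++ [ y ]) ≡ just y
  last-snoc l y = last-++ l [ y ] refl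

  last-map : ∀ {B : Set} (f : A → B) (l : List A) {x} → last l ≡ just x → last (map f l) ≡ just (f x)
  last-map f (y ∷ [])     refl = refl
  last-map f (y ∷ y' ∷ l) lt   = last-map f (y' ∷ l) lt

  last-∷-∃ : ∀ (y : A) ys → ∃[ z ] (last (y ∷ ys) ≡ just z)
  last-∷-∃ y []        = y , refl
  last-∷-∃ y (y' ∷ ys) = last-∷-∃ y' ys

  Unique-last≢head : ∀ (y : A) zs → Unique (y ∷ zs) → zs ≢ [] → last (y ∷ zs) ≢ just y
  Unique-last≢head y []       _         zs≢[] _  = zs≢[] refl
  Unique-last≢head y (z ∷ zs) (y∉ ∷ _) _     lt = lookup y∉ (last-∈ (z ∷ zs) lt) refl

  Unique-++⁻ˡ : ∀ (xs ys : List A) → Unique (xs ++ ys) → Unique xs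
  Unique-++⁻ˡ []       ys _          = []
  Unique-++⁻ˡ (x ∷ xs) ys (x∉ ∷ u) = All.++⁻ˡ xs x∉ ∷ Unique-++⁻ˡ xs ys u

IsWalk : ∀ {A : Set} → Rel A 0ℓ → A → A → List A → Set
IsWalk R u w l = Linked R l × head l ≡ just u × last l ≡ just w

module _ {A : Set} {R : Rel A 0ℓ} where

  Linked-++ˡ : ∀ l m → Linked R (l ++ m) → Linked R l
  Linked-++ˡ []          m _          = []
  Linked-++ˡ (x ∷ [])    m _          = [-]
  Linked-++ˡ (x ∷ y ∷ l) m (r ∷ lk)  = r ∷ Linked-++ˡ (y ∷ l) m lk

  Linked-snoc⁻ : ∀ l y {x} → last l ≡ just x → Linked R (l ++ [ y ]) → R x y
  Linked-snoc⁻ (z ∷ [])     y refl (r ∷ _)  = r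
  Linked-snoc⁻ (z ∷ z' ∷ l) y lt   (_ ∷ lk) = Linked-snoc⁻ (z' ∷ l) y lt lk

  Linked-++⁺ : ∀ {x y} l m → Linked R l → Linked R m → last l ≡ just x → head m ≡ just y → R x y → Linked R (l ++ m)
  Linked-++⁺ (z ∷ [])     (y ∷ m) [-]       lkm refl refl r = r ∷ lkm
  Linked-++⁺ (z ∷ z' ∷ l) m       (r' ∷ lk) lkm lt   hd   r = r' ∷ Linked-++⁺ (z' ∷ l) m lk lkm lt hd r

  Linked-snoc⁺ : ∀ {x} l y → Linked R l → last l ≡ just x → R x y → Linked R (l ++ [ y ])
  Linked-snoc⁺ l y lk lt r = Linked-++⁺ l [ y ] lk [-] lt refl r

  Linked-map-All : ∀ {S : Rel A 0ℓ} (P : A → Set) → (∀ {x y} → P x → P y → R x y → S x y) →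
                   ∀ l → All P l → Linked R l → Linked S l
  Linked-map-All P f []          _              _        = []
  Linked-map-All P f (x ∷ [])    _              _        = [-]
  Linked-map-All P f (x ∷ y ∷ l) (px ∷ py ∷ ps) (r ∷ lk) = f px py r ∷ Linked-map-All P f (y ∷ l) (py ∷ ps) lk

  Linked-bracket⁻ : ∀ {B : Set} (f : B → A) {x y q₀ q₁} Q → head Q ≡ just q₀ → last Q ≡ just q₁ →
                    Linked R (x ∷ (map f Q ++ [ y ])) → R x (f q₀) × Linked (λ u v → R (f u) (f v)) Q × R (f q₁) y
  Linked-bracket⁻ f {y = y} (q ∷ Q) refl lt (r ∷ lk) =
    r , Linked.map⁻ (Linked-++ˡ (map f (q ∷ Q)) [ y ] lk) , Linked-snoc⁻ (map f (q ∷ Q)) y (last-map f (q ∷ Q) lt) lk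

  Star⇒walk : ∀ {u w} → Star R u w → ∃[ l ] IsWalk R u w l
  Star⇒walk {u} ε = [ u ] , [-] , refl , refl
  Star⇒walk {u} (r ◅ rs) with Star⇒walk rs
  ... | y ∷ l , lk , refl , lt = u ∷ y ∷ l , r ∷ lk , refl , lt

  walk⇒Star : ∀ {u w} l → IsWalk R u w l → Star R u w
  walk⇒Star (x ∷ [])    (_ , refl , refl)    = ε
  walk⇒Star (x ∷ y ∷ l) (r ∷ lk , refl , lt) = r ◅ walk⇒Star (y ∷ l) (lk , refl , lt)

  prefix⇒Star : ∀ {x z} l → Linked R l → head l ≡ just x → z ∈ l → Star R x z
  prefix⇒Star (y ∷ l)      lk       refl (here refl) = ε
  prefix⇒Star (y ∷ y' ∷ l) (r ∷ lk) refl (there z∈)  = r ◅ prefix⇒Star (y' ∷ l) lk refl z∈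

  suffix⇒Star : ∀ {y z} l → Linked R l → last l ≡ just y → z ∈ l → Star R z y
  suffix⇒Star (x ∷ [])     lk       refl (here refl) = ε
  suffix⇒Star (x ∷ x' ∷ l) (r ∷ lk) lt   (here refl) = r ◅ suffix⇒Star (x' ∷ l) lk lt (here refl)
  suffix⇒Star (x ∷ x' ∷ l) (r ∷ lk) lt   (there z∈)  = suffix⇒Star (x' ∷ l) lk lt z∈

  walk-leaves : ∀ (P : A → Set) → (∀ z → Dec (P z)) → ∀ {x y} l → IsWalk R x y l → P x → ¬ P y →
                ∃[ s ] ∃[ t ] (R s t × P s × ¬ P t)
  walk-leaves P P? l (lk , hd , lt) = go l lk hd lt
    where
    go : ∀ {x y} l → Linked R l → head l ≡ just x → last l ≡ just y → P x → ¬ P y → ∃[ s ] ∃[ t ] (R s t × P s × ¬ P t)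
    go (z ∷ [])     _        refl refl Px ¬Py = ⊥-elim (¬Py Px)
    go (z ∷ z' ∷ l) (r ∷ lk) refl lt   Px ¬Py with P? z'
    ... | yes Pz' = go (z' ∷ l) lk refl lt Pz' ¬Py
    ... | no ¬Pz' = z , z' , r , Px , ¬Pz'

  module _ (_≟_ : DecidableEquality A) where

    suffix-walk : ∀ {x w} p → x ∈ p → Unique p → Linked R p → last p ≡ just w → ∃[ s ] (Unique s × IsWalk R x w s)
    suffix-walk (y ∷ p)     (here refl) up      lk lt = y ∷ p , up , lk , refl , lt
    suffix-walk (y ∷ [])    (there ())  _       _  _
    suffix-walk (y ∷ z ∷ p) (there x∈)  (_ ∷ up) lk lt = suffix-walk (z ∷ p) x∈ up (Linked.tail lk) lt

    -- a walk is shortened to a path by cutting out every closed subwalk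
    walk⇒path : ∀ {u w} l → IsWalk R u w l → ∃[ p ] (Unique p × IsWalk R u w p)
    walk⇒path (x ∷ [])    (lk , refl , lt)     = x ∷ [] , [] ∷ [] , lk , refl , lt
    walk⇒path (x ∷ y ∷ l) (r ∷ lk , refl , lt) with walk⇒path (y ∷ l) (lk , refl , lt)
    ... | p , up , lkp , hp , ltp with any? (x ≟_) p
    ...   | yes x∈p = suffix-walk p x∈p up lkp ltp
    walk⇒path (x ∷ y ∷ l) (r ∷ lk , refl , lt) | y ∷ p , up , lkp , refl , ltp | no x∉p =
      x ∷ y ∷ p , ¬Any⇒All¬ (y ∷ p) x∉p ∷ up , r ∷ lkp , refl , ltp

    Star⇒path : ∀ {u w} → Star R u w → ∃[ p ] (Unique p × IsWalk R u w p)
    Star⇒path rs = let (l , walk) = Star⇒walk rs in walk⇒path l walk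

Unique⇒length≤ : ∀ {n} (xs : List (Fin n)) → Unique xs → length xs ≤ n
Unique⇒length≤ []       _ = z≤n
Unique⇒length≤ {zero}  (() ∷ _) _
Unique⇒length≤ {suc n} (x ∷ xs) (x∉ ∷ u) =
  s≤s (≤-trans (≤-reflexive (sym (length-punchOuts xs x∉))) (Unique⇒length≤ (punchOuts xs x∉) (Unique-punchOuts xs x∉ u)))
  where
  punchOuts : ∀ ys → All (x ≢_) ys → List (Fin n)
  punchOuts []       _          = []
  punchOuts (y ∷ ys) (x≢y ∷ ps) = punchOut x≢y ∷ punchOuts ys ps

  length-punchOuts : ∀ ys ps → length (punchOuts ys ps) ≡ length ys
  length-punchOuts []       _        = refl
  length-punchOuts (y ∷ ys) (_ ∷ ps) = cong suc (length-punchOuts ys ps)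

  ∈-punchOuts⁻ : ∀ {z} ys ps → z ∈ punchOuts ys ps → ∃[ y ] ∃[ x≢y ] (y ∈ ys × z ≡ punchOut {i = x} {j = y} x≢y)
  ∈-punchOuts⁻ (y ∷ ys) (x≢y ∷ ps) (here refl) = y , x≢y , here refl , refl
  ∈-punchOuts⁻ (y ∷ ys) (_ ∷ ps)   (there z∈) with y' , x≢y' , y'∈ , refl ← ∈-punchOuts⁻ ys ps z∈ = y' , x≢y' , there y'∈ , refl

  Unique-punchOuts : ∀ ys ps → Unique ys → Unique (punchOuts ys ps)
  Unique-punchOuts []       _          _          = []
  Unique-punchOuts (y ∷ ys) (x≢y ∷ ps) (y∉ ∷ u) = tabulate distinct ∷ Unique-punchOuts ys ps u
    where
    distinct : ∀ {z} → z ∈ punchOuts ys ps → punchOut x≢y ≢ z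
    distinct z∈ eq with y' , x≢y' , y'∈ , refl ← ∈-punchOuts⁻ ys ps z∈ = lookup y∉ y'∈ (punchOut-injective x≢y x≢y' eq)

module _ {n : ℕ} where

  listsUpTo : ℕ → List (List (Fin n))
  listsUpTo zero    = [ [] ]
  listsUpTo (suc k) = [] ∷ concatMap (λ x → map (x ∷_) (listsUpTo k)) (allFin n)

  ∈-listsUpTo : ∀ k (l : List (Fin n)) → length l ≤ k → l ∈ listsUpTo k
  ∈-listsUpTo zero    []      _          = here refl
  ∈-listsUpTo (suc k) []      _          = here refl
  ∈-listsUpTo (suc k) (x ∷ l) (s≤s l≤k) =
    there (∈-concat⁺′ (∈-map⁺ (x ∷_) (∈-listsUpTo k l l≤k)) (∈-map⁺ (λ x → map (x ∷_) (listsUpTo k)) (∈-allFin x)))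

  -- reachability is decided by searching the finitely many repetition-free lists
  Star? : {R : Rel (Fin n) 0ℓ} → (∀ x y → Dec (R x y)) → ∀ u w → Dec (Star R u w)
  Star? {R} R? u w with any? isPath? (listsUpTo n)
    where
    isPath? : ∀ p → Dec (Unique p × IsWalk R u w p)
    isPath? p = allPairs? (λ x y → ¬? (x Fin.≟ y)) p ×-dec linked? R? p
                ×-dec Maybe.≡-dec Fin._≟_ (head p) (just u) ×-dec Maybe.≡-dec Fin._≟_ (last p) (just w)
  ... | yes found = let (p , _ , _ , walk) = find found in yes (walk⇒Star p walk)
  ... | no none   = no λ rs → let (p , up , walk) = Star⇒path Fin._≟_ rs in
                              none (lose (∈-listsUpTo n p (Unique⇒length≤ p up)) (up , walk))

module _ {n : ℕ} where

  _≟ₑ_ : DecidableEquality (Edge n)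
  _≟ₑ_ = ≡-dec Fin._≟_ Fin._≟_

  open import Data.List.Membership.DecPropositional _≟ₑ_ using (_∈?_)

  Adj? : ∀ (F : List (Edge n)) x y → Dec (Adj F x y)
  Adj? F x y = ((x , y) ∈? F) ⊎-dec ((y , x) ∈? F)

  Adj-sym : ∀ {F : List (Edge n)} {x y} → Adj F x y → Adj F y x
  Adj-sym (inj₁ xy∈) = inj₂ xy∈
  Adj-sym (inj₂ yx∈) = inj₁ yx∈

  Adj-reverse : ∀ {F : List (Edge n)} {x y} → Star (Adj F) x y → Star (Adj F) y x
  Adj-reverse = Star.reverse Adj-sym

  IsCycle-rotate₁ : ∀ {F : List (Edge n)} x y ys → IsCycle F (x ∷ y ∷ ys) → IsCycle F (y ∷ ys ++ [ x ])
  IsCycle-rotate₁ {F} x y ys (3≤ , (x∉ ∷ u) , (r ∷ lk)) =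
    subst (3 ≤_) (cong suc (length-++-comm [ x ] ys)) 3≤ ,
    Unique.++⁺ u ([] ∷ []) (λ { (x∈ , here refl) → lookup x∉ x∈ refl }) ,
    Linked-snoc⁺ (y ∷ ys ++ [ x ]) y lk (last-snoc (y ∷ ys) x) r

  IsCycle-rotate : ∀ {F : List (Edge n)} pre z post → IsCycle F (pre ++ z ∷ post) → IsCycle F (z ∷ post ++ pre)
  IsCycle-rotate {F} []           z post cyc = subst (λ l → IsCycle F (z ∷ l)) (sym (++-identityʳ post)) cyc
  IsCycle-rotate {F} (x ∷ [])     z post cyc = IsCycle-rotate₁ x z post cyc
  IsCycle-rotate {F} (x ∷ p ∷ pre) z post cyc =
    subst (λ l → IsCycle F (z ∷ l)) (++-assoc post [ x ] (p ∷ pre))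
      (IsCycle-rotate (p ∷ pre) z (post ++ [ x ])
        (subst (IsCycle F) (cong (p ∷_) (++-assoc pre (z ∷ post) [ x ])) (IsCycle-rotate₁ x p (pre ++ z ∷ post) cyc)))

  module _ {F : List (Edge n)} {u w : Fin n} where

    Adj-∷⁻ : ∀ {x y} → Adj ((u , w) ∷ F) x y → Adj F x y ⊎ ((x ≡ u × y ≡ w) ⊎ (x ≡ w × y ≡ u))
    Adj-∷⁻ (inj₁ (here refl))  = inj₂ (inj₁ (refl , refl))
    Adj-∷⁻ (inj₁ (there xy∈)) = inj₁ (inj₁ xy∈)
    Adj-∷⁻ (inj₂ (here refl))  = inj₂ (inj₂ (refl , refl))
    Adj-∷⁻ (inj₂ (there yx∈)) = inj₁ (inj₂ yx∈)

    Adj-∷-avoiding : ∀ {x y} → u ≢ x → u ≢ y → Adj ((u , w) ∷ F) x y → Adj F x y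
    Adj-∷-avoiding u≢x u≢y xy with Adj-∷⁻ xy
    ... | inj₁ xy∈F                = xy∈F
    ... | inj₂ (inj₁ (refl , _))  = ⊥-elim (u≢x refl)
    ... | inj₂ (inj₂ (_ , refl))  = ⊥-elim (u≢y refl)

    -- a cycle through the new edge uw would leave a walk from u to w in F
    Acyclic-∷ : u ≢ w → Acyclic F → ¬ Star (Adj F) u w → Acyclic ((u , w) ∷ F)
    Acyclic-∷ u≢w acyclic disconnected [] ()
    Acyclic-∷ u≢w acyclic disconnected c@(x ∷ xs) cyc@(3≤ , uniq , lk) with any? (u Fin.≟_) c
    ... | no u∉c = acyclic c (3≤ , uniq , Linked-map-All (u ≢_) Adj-∷-avoiding (c ++ [ x ]) avoids lk)
      where
      avoids : All (u ≢_) (c ++ [ x ])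
      avoids = tabulate λ {z} z∈ u≡z → u∉c (subst (_∈ c) (sym u≡z) (closing z∈))
        where
        closing : ∀ {z} → z ∈ c ++ [ x ] → z ∈ c
        closing z∈ with ∈-++⁻ c z∈
        ... | inj₁ z∈c        = z∈c
        ... | inj₂ (here refl) = here refl
    ... | yes u∈c with pre , post , c≡ ← ∈-∃++ u∈c with IsCycle-rotate pre u post (subst (IsCycle _) c≡ cyc)
    ...   | 3≤′ , uniq′ , lk′ = through-u (post ++ pre) 3≤′ uniq′ lk′
      where
      through-u : ∀ ys → 3 ≤ length (u ∷ ys) → Unique (u ∷ ys) → Linked (Adj ((u , w) ∷ F)) (u ∷ ys ++ [ u ]) → ⊥
      through-u []         (s≤s ()) _ _
      through-u (y ∷ ys) 3≤ (u∉ ∷ uniqys) (first ∷ lk) with z , last≡z ← last-∷-∃ y ys =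
        ends (Adj-∷⁻ first) (Adj-∷⁻ (Linked-snoc⁻ (y ∷ ys) u last≡z lk))
        where
        ys≢[] : ys ≢ []
        ys≢[] refl = <-irrefl refl (≤-pred 3≤)
        inner : Linked (Adj F) (y ∷ ys)
        inner = Linked-map-All (u ≢_) Adj-∷-avoiding (y ∷ ys) u∉ (Linked-++ˡ (y ∷ ys) [ u ] lk)
        ends : Adj F u y ⊎ ((u ≡ u × y ≡ w) ⊎ (u ≡ w × y ≡ u)) → Adj F z u ⊎ ((z ≡ u × u ≡ w) ⊎ (z ≡ w × u ≡ u)) → ⊥
        ends (inj₂ (inj₂ (u≡w , _))) _                         = u≢w u≡w
        ends _                         (inj₂ (inj₁ (_ , u≡w))) = u≢w u≡w
        ends (inj₁ uy) (inj₁ zu) =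
          acyclic (u ∷ y ∷ ys) (3≤ , (u∉ ∷ uniqys) , uy ∷ Linked-snoc⁺ (y ∷ ys) u inner last≡z zu)
        ends (inj₂ (inj₁ (_ , refl))) (inj₁ zu) =
          disconnected (Adj-reverse (walk⇒Star (y ∷ ys ++ [ u ]) (Linked-snoc⁺ (y ∷ ys) u inner last≡z zu , refl , last-snoc (y ∷ ys) u)))
        ends (inj₁ uy) (inj₂ (inj₂ (refl , _))) =
          disconnected (walk⇒Star (u ∷ y ∷ ys) (uy ∷ inner , refl , last≡z))
        ends (inj₂ (inj₁ (_ , refl))) (inj₂ (inj₂ (refl , _))) = Unique-last≢head y ys uniqys ys≢[] last≡z

  removeEdge : List (Edge n) → Fin n → Fin n → List (Edge n)
  removeEdge F a b = filter (λ e → ¬? ((e ≟ₑ (a , b)) ⊎-dec (e ≟ₑ (b , a)))) F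

  module _ {F : List (Edge n)} {a b : Fin n} where

    private
      F∖ab : List (Edge n)
      F∖ab = removeEdge F a b

      kept? : ∀ (e : Edge n) → Dec (¬ (e ≡ (a , b) ⊎ e ≡ (b , a)))
      kept? e = ¬? ((e ≟ₑ (a , b)) ⊎-dec (e ≟ₑ (b , a)))

    Adj-removeEdge⁻ : ∀ {x y} → Adj F∖ab x y → Adj F x y
    Adj-removeEdge⁻ (inj₁ xy∈) = inj₁ (proj₁ (∈-filter⁻ kept? {xs = F} xy∈))
    Adj-removeEdge⁻ (inj₂ yx∈) = inj₂ (proj₁ (∈-filter⁻ kept? {xs = F} yx∈))

    Adj-removeEdge⁺ : ∀ {x y} → Adj F x y → ¬ ((x ≡ a × y ≡ b) ⊎ (x ≡ b × y ≡ a)) → Adj F∖ab x y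
    Adj-removeEdge⁺ (inj₁ xy∈) ¬ab =
      inj₁ (∈-filter⁺ kept? xy∈ λ { (inj₁ refl) → ¬ab (inj₁ (refl , refl)) ; (inj₂ refl) → ¬ab (inj₂ (refl , refl)) })
    Adj-removeEdge⁺ (inj₂ yx∈) ¬ab =
      inj₂ (∈-filter⁺ kept? yx∈ λ { (inj₁ refl) → ¬ab (inj₂ (refl , refl)) ; (inj₂ refl) → ¬ab (inj₁ (refl , refl)) })

    ¬Adj-removeEdge : ¬ Adj F∖ab a b
    ¬Adj-removeEdge (inj₁ ab∈) = proj₂ (∈-filter⁻ kept? {xs = F} ab∈) (inj₁ refl)
    ¬Adj-removeEdge (inj₂ ba∈) = proj₂ (∈-filter⁻ kept? {xs = F} ba∈) (inj₂ refl)

    Adj-removeEdge-avoiding : ∀ {x y} → a ≢ x → a ≢ y → Adj F x y → Adj F∖ab x y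
    Adj-removeEdge-avoiding a≢x a≢y xy = Adj-removeEdge⁺ xy λ { (inj₁ (refl , _)) → a≢x refl ; (inj₂ (_ , refl)) → a≢y refl }

    module _ (acyclic : Acyclic F) (ab : Adj F a b) (a≢b : a ≢ b) where

      removeEdge-separates : ¬ Star (Adj F∖ab) a b
      removeEdge-separates a↝b with Star⇒path Fin._≟_ a↝b
      ... | x ∷ [] , _ , _ , refl , refl = a≢b refl
      ... | x ∷ y ∷ [] , _ , (xy ∷ _) , refl , refl = ¬Adj-removeEdge xy
      ... | x ∷ y ∷ z ∷ q , uniq , lk , refl , lt =
        acyclic (x ∷ y ∷ z ∷ q)
          (s≤s (s≤s (s≤s z≤n)) , uniq , Linked-snoc⁺ (x ∷ y ∷ z ∷ q) x (Linked.map Adj-removeEdge⁻ lk) lt (Adj-sym ab))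

      -- a path from a uses the edge ab, if at all, as its first step
      removeEdge-split : ∀ {t} → Star (Adj F) a t → Star (Adj F∖ab) a t ⊎ Star (Adj F∖ab) b t
      removeEdge-split a↝t with Star⇒path Fin._≟_ a↝t
      ... | x ∷ [] , _ , _ , refl , refl = inj₁ ε
      ... | x ∷ y ∷ rest , (a∉ ∷ _) , (xy ∷ lk) , refl , lt with y Fin.≟ b
      ...   | yes refl = inj₂ (walk⇒Star (y ∷ rest) (avoiding , refl , lt))
        where
        avoiding : Linked (Adj F∖ab) (y ∷ rest)
        avoiding = Linked-map-All (a ≢_) Adj-removeEdge-avoiding (y ∷ rest) a∉ lk
      ...   | no y≢b  = inj₁ (walk⇒Star (x ∷ y ∷ rest) (xy′ ∷ avoiding , refl , lt))
        where
        avoiding : Linked (Adj F∖ab) (y ∷ rest)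
        avoiding = Linked-map-All (a ≢_) Adj-removeEdge-avoiding (y ∷ rest) a∉ lk
        xy′ : Adj F∖ab x y
        xy′ = Adj-removeEdge⁺ xy λ { (inj₁ (_ , y≡b)) → y≢b y≡b ; (inj₂ (a≡b , _)) → a≢b a≡b }

    -- the two halves are disjoint because x and y are separated in F ∖ ab
    join-at-edge : ∀ {s t x y} → Adj F x y → ¬ Star (Adj F∖ab) x y → Star (Adj F∖ab) s x → Star (Adj F∖ab) y t →
                   ∃[ p ] (IsPath F s t p × x ∈ p × y ∈ p)
    join-at-edge {s} {t} xy separated s↝x y↝t
      with p₁ , u₁ , lk₁ , hd₁ , lt₁ ← Star⇒path Fin._≟_ s↝x
         | p₂ , u₂ , lk₂ , hd₂ , lt₂ ← Star⇒path Fin._≟_ y↝t =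
      p₁ ++ p₂ ,
      (Unique.++⁺ u₁ u₂ disjoint ,
       Linked-++⁺ p₁ p₂ (Linked.map Adj-removeEdge⁻ lk₁) (Linked.map Adj-removeEdge⁻ lk₂) lt₁ hd₂ xy ,
       head-++ p₁ p₂ hd₁ ,
       last-++ p₁ p₂ lt₂) ,
      ∈-++⁺ˡ (last-∈ p₁ lt₁) ,
      ∈-++⁺ʳ p₁ (head-∈ p₂ hd₂)
      where
      disjoint : ∀ {z} → ¬ (z ∈ p₁ × z ∈ p₂)
      disjoint (z∈₁ , z∈₂) =
        separated (Adj-reverse (suffix⇒Star p₁ lk₁ lt₁ z∈₁) ◅◅ Adj-reverse (prefix⇒Star p₂ lk₂ hd₂ z∈₂))

MaximalSpanningForest-connects : ∀ (G : Graph) F → IsMaximalSpanningForest G F → ∀ {u w} → (u , w) ∈ E G → Star (Adj F) u w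
MaximalSpanningForest-connects G F (_ , _ , acyclic , maximal) {u} {w} uw∈ with Star? (Adj? F) u w
... | yes u↝w = u↝w
... | no ¬u↝w = ⊥-elim (maximal (u , w) uw∈ (λ uw∈F → ¬u↝w (inj₁ uw∈F ◅ ε)) (Acyclic-∷ u≢w acyclic ¬u↝w))
  where
  u≢w : u ≢ w
  u≢w refl = <-irrefl refl (lookup (ordered G) uw∈)

half : ∀ m → Bool → Fin m → Fin (m + m)
half m true  i = i ↑ˡ m
half m false i = m ↑ʳ i

data Halves (m : ℕ) : Fin (m + m) → Set where
  halfOf : ∀ s i → Halves m (half m s i)

halves : ∀ m j → Halves m j
halves m j with splitAt m j in eq
... | inj₁ i = subst (Halves m) (splitAt⁻¹-↑ˡ eq) (halfOf true i)
... | inj₂ i = subst (Halves m) (splitAt⁻¹-↑ʳ eq) (halfOf false i)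

whichHalf : ∀ m → Fin (m + m) → Bool × Fin m
whichHalf m j = [ (true ,_) , (false ,_) ]′ (splitAt m j)

whichHalf-half : ∀ m s i → whichHalf m (half m s i) ≡ (s , i)
whichHalf-half m true  i rewrite splitAt-↑ˡ m i m = refl
whichHalf-half m false i rewrite splitAt-↑ʳ m m i = refl

offset : ℕ → Bool → ℕ
offset m true  = 0
offset m false = m

toℕ-half : ∀ m s i → toℕ (half m s i) ≡ offset m s + toℕ i
toℕ-half m true  i = toℕ-↑ˡ i m
toℕ-half m false i = toℕ-↑ʳ m i

half-injective : ∀ m s {i j} → half m s i ≡ half m s j → i ≡ j
half-injective m true  = ↑ˡ-injective m _ _
half-injective m false = ↑ʳ-injective m _ _

half-sides : ∀ m {s s'} i j → half m s i ≡ half m s' j → s ≡ s'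
half-sides m {s} {s'} i j eq = cong proj₁ (trans (sym (whichHalf-half m s i)) (trans (cong (whichHalf m) eq) (whichHalf-half m s' j)))

half-disjoint : ∀ m s i j → half m s i ≢ half m (not s) j
half-disjoint m true  i j eq with () ← half-sides m {true} {false} i j eq
half-disjoint m false i j eq with () ← half-sides m {false} {true} i j eq

half-mono-< : ∀ m s {i j} → toℕ i < toℕ j → toℕ (half m s i) < toℕ (half m s j)
half-mono-< m s {i} {j} i<j rewrite toℕ-half m s i | toℕ-half m s j = +-monoʳ-< (offset m s) i<j

mutual
  size : ℕ → ℕ
  size d = suc (suc (innerSize d))

  innerSize : ℕ → ℕ
  innerSize zero    = 0
  innerSize (suc d) = size d + size d

V : ℕ → Set
V d = Fin (size d)

-- the vertices 0 and 1 of G_d are its ports; G_{d+1} puts its copy of G_d on side s into half s of the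
-- vertices after its own ports
embed : ∀ d → Bool → V d → V (suc d)
embed d s i = suc (suc (half (size d) s i))

embed-injective : ∀ d s {i j} → embed d s i ≡ embed d s j → i ≡ j
embed-injective d s = half-injective (size d) s ∘ suc-injective ∘ suc-injective

embed-disjoint : ∀ d s i j → embed d s i ≢ embed d (not s) j
embed-disjoint d s i j = half-disjoint (size d) s i j ∘ suc-injective ∘ suc-injective

mapEdge : ∀ {m n} → (Fin m → Fin n) → Edge m → Edge n
mapEdge f (u , w) = f u , f w

mutual
  edges : ∀ d → List (Edge (size d))
  edges zero    = [ (zero , suc zero) ]
  edges (suc d) = copyEdges d true ++ copyEdges d false

  copyEdges : ∀ d → Bool → List (Edge (size (suc d)))
  copyEdges d s = (zero , embed d s zero) ∷ (suc zero , embed d s (suc zero)) ∷ map (mapEdge (embed d s)) (edges d)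

edges-ordered : ∀ d → All (λ e → toℕ (proj₁ e) < toℕ (proj₂ e)) (edges d)
edges-ordered zero    = s≤s z≤n ∷ []
edges-ordered (suc d) = All.++⁺ (copy-ordered true) (copy-ordered false)
  where
  copy-ordered : ∀ s → All (λ e → toℕ (proj₁ e) < toℕ (proj₂ e)) (copyEdges d s)
  copy-ordered s = s≤s z≤n ∷ s≤s (s≤s z≤n) ∷ All.map⁺ (All.map (s≤s ∘ s≤s ∘ half-mono-< (size d) s) (edges-ordered d))

mapEdge-injective : ∀ {m n} (f : Fin m → Fin n) → (∀ {a b} → f a ≡ f b → a ≡ b) → ∀ {e e'} → mapEdge f e ≡ mapEdge f e' → e ≡ e'
mapEdge-injective f f-inj {_ , _} {_ , _} eq = cong₂ _,_ (f-inj (cong proj₁ eq)) (f-inj (cong proj₂ eq))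

edges-unique : ∀ d → Unique (edges d)
edges-unique zero    = [] ∷ []
edges-unique (suc d) = Unique.++⁺ (copy-unique true) (copy-unique false) copies-disjoint
  where
  copy-unique : ∀ s → Unique (copyEdges d s)
  copy-unique s =
    ((λ ()) ∷ All.map⁺ (universal (λ { (_ , _) () }) (edges d))) ∷
    All.map⁺ (universal (λ { (_ , _) () }) (edges d)) ∷
    Unique.map⁺ (mapEdge-injective (embed d s) (embed-injective d s)) (edges-unique d)
  copies-disjoint : ∀ {e} → ¬ (e ∈ copyEdges d true × e ∈ copyEdges d false)
  copies-disjoint (here refl , here eq) = embed-disjoint d true zero zero (cong proj₂ eq)
  copies-disjoint (here refl , there (here ()))
  copies-disjoint (here refl , there (there e∈)) with (_ , _) , _ , () ← ∈-map⁻ (mapEdge (embed d false)) e∈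
  copies-disjoint (there (here refl) , here ())
  copies-disjoint (there (here refl) , there (here eq)) = embed-disjoint d true (suc zero) (suc zero) (cong proj₂ eq)
  copies-disjoint (there (here refl) , there (there e∈)) with (_ , _) , _ , () ← ∈-map⁻ (mapEdge (embed d false)) e∈
  copies-disjoint (there (there e∈) , e∈') with (p , q) , _ , refl ← ∈-map⁻ (mapEdge (embed d true)) e∈ = inner∉ p q e∈'
    where
    inner∉ : ∀ p q → (embed d true p , embed d true q) ∉ copyEdges d false
    inner∉ p q (there (there e∈)) with (p' , _) , _ , eq ← ∈-map⁻ (mapEdge (embed d false)) e∈ = embed-disjoint d true p p' (cong proj₁ eq)

graph : ℕ → Graph
graph d = record { n = size d ; E = edges d ; ordered = edges-ordered d ; nodup = edges-unique d }

data VertexView (d : ℕ) : V (suc d) → Set where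
  port₀ : VertexView d zero
  port₁ : VertexView d (suc zero)
  inner : ∀ s i → VertexView d (embed d s i)

vertexView : ∀ d v → VertexView d v
vertexView d zero          = port₀
vertexView d (suc zero)    = port₁
vertexView d (suc (suc j)) with halves (size d) j
... | halfOf s i = inner s i

count-edges-suc : ∀ d s (p : Edge (size (suc d)) → Bool) → count p (edges (suc d)) ≡ count p (copyEdges d s) + count p (copyEdges d (not s))
count-edges-suc d true  p = count-++ p (copyEdges d true) (copyEdges d false)
count-edges-suc d false p = trans (count-++ p (copyEdges d true) (copyEdges d false)) (+-comm (count p (copyEdges d true)) _)

incident-mapEdge : ∀ {m n} (f : Fin m → Fin n) → (∀ {a b} → f a ≡ f b → a ≡ b) →
                   ∀ i e → incidentᵇ (f i) (mapEdge f e) ≡ incidentᵇ i e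
incident-mapEdge f f-inj i (x , y) rewrite ==-∘-injective f f-inj x i | ==-∘-injective f f-inj y i = refl

incident-mapEdge-disjoint : ∀ {m n} (f g : Fin m → Fin n) → (∀ a b → f a ≢ g b) → ∀ i e → incidentᵇ (f i) (mapEdge g e) ≡ false
incident-mapEdge-disjoint f g f≢g i (x , y) rewrite ==-≢ (f≢g i x ∘ sym) | ==-≢ (f≢g i y ∘ sym) = refl

count-copyEdges : ∀ d s (p : Edge (size (suc d)) → Bool) → count p (copyEdges d s) ≡
  indicator (p (zero , embed d s zero)) + (indicator (p (suc zero , embed d s (suc zero))) + count (p ∘ mapEdge (embed d s)) (edges d))
count-copyEdges d s p =
  trans (count-∷ p _ _) (cong (indicator (p (zero , embed d s zero)) +_)
    (trans (count-∷ p _ _) (cong (indicator (p (suc zero , embed d s (suc zero))) +_) (count-map p _ (edges d)))))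

degree-embed-own : ∀ d s i → count (incidentᵇ (embed d s i)) (copyEdges d s) ≡
                   indicator (zero == i) + (indicator (suc zero == i) + count (incidentᵇ i) (edges d))
degree-embed-own d s i = trans (count-copyEdges d s (incidentᵇ (embed d s i)))
  (cong₂ _+_ (cong indicator (==-∘-injective (embed d s) (embed-injective d s) zero i))
    (cong₂ _+_ (cong indicator (==-∘-injective (embed d s) (embed-injective d s) (suc zero) i))
      (count-cong (incident-mapEdge (embed d s) (embed-injective d s) i) (edges d))))

degree-embed-other : ∀ d s i → count (incidentᵇ (embed d s i)) (copyEdges d (not s)) ≡ 0
degree-embed-other d s i = trans (count-copyEdges d (not s) (incidentᵇ (embed d s i)))
  (cong₂ _+_ (cong indicator (==-≢ (embed-disjoint d s i zero ∘ sym)))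
    (cong₂ _+_ (cong indicator (==-≢ (embed-disjoint d s i (suc zero) ∘ sym)))
      (count-none (incident-mapEdge-disjoint (embed d s) (embed d (not s)) (embed-disjoint d s) i) (edges d))))

degree-port₀ : ∀ d s → count (incidentᵇ zero) (copyEdges d s) ≡ 1
degree-port₀ d s = trans (count-copyEdges d s (incidentᵇ zero)) (cong suc (count-none (λ { (_ , _) → refl }) (edges d)))

degree-port₁ : ∀ d s → count (incidentᵇ (suc zero)) (copyEdges d s) ≡ 1
degree-port₁ d s = trans (count-copyEdges d s (incidentᵇ (suc zero))) (cong suc (count-none (λ { (_ , _) → refl }) (edges d)))

portCap : ∀ {n} → Fin n → ℕ
portCap zero          = 2
portCap (suc zero)    = 2
portCap (suc (suc _)) = 3

degree≤portCap : ∀ d v → degree (graph d) v ≤ portCap v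
degree≤portCap zero    zero       = s≤s z≤n
degree≤portCap zero    (suc zero) = s≤s z≤n
degree≤portCap (suc d) v with vertexView d v
... | port₀ = ≤-reflexive (trans (count-edges-suc d true (incidentᵇ zero)) (cong₂ _+_ (degree-port₀ d true) (degree-port₀ d false)))
... | port₁ = ≤-reflexive (trans (count-edges-suc d true (incidentᵇ (suc zero))) (cong₂ _+_ (degree-port₁ d true) (degree-port₁ d false)))
... | inner s i = subst (_≤ 3) (sym degree≡) (attach i (degree≤portCap d i))
  where
  degree≡ : degree (graph (suc d)) (embed d s i) ≡ indicator (zero == i) + (indicator (suc zero == i) + degree (graph d) i)
  degree≡ = trans (count-edges-suc d s (incidentᵇ (embed d s i)))
                  (trans (cong₂ _+_ (degree-embed-own d s i) (degree-embed-other d s i)) (+-identityʳ _))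
  attach : ∀ {n} (i : Fin (suc (suc n))) {c} → c ≤ portCap i → indicator (zero == i) + (indicator (suc zero == i) + c) ≤ 3
  attach zero          c≤2 = s≤s c≤2
  attach (suc zero)    c≤2 = s≤s c≤2
  attach (suc (suc _)) c≤3 = c≤3

maxDegree≤3 : ∀ d → MaxDegreeAtMost 3 (graph d)
maxDegree≤3 d v = ≤-trans (degree≤portCap d v) (portCap≤3 v)
  where
  portCap≤3 : ∀ {n} (v : Fin n) → portCap v ≤ 3
  portCap≤3 zero          = s≤s (s≤s z≤n)
  portCap≤3 (suc zero)    = s≤s (s≤s z≤n)
  portCap≤3 (suc (suc _)) = ≤-refl

embed-injective₂ : ∀ d s s' i j → embed d s i ≡ embed d s' j → s ≡ s' × i ≡ j
embed-injective₂ d s s' i j eq with refl ← half-sides (size d) {s} {s'} i j (suc-injective (suc-injective eq)) =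
  refl , embed-injective d s eq

mutual
  nodeCount : ℕ → ℕ
  nodeCount d = suc (innerNodeCount d)

  innerNodeCount : ℕ → ℕ
  innerNodeCount zero    = 0
  innerNodeCount (suc d) = nodeCount d + nodeCount d

TreeNode : ℕ → Set
TreeNode d = Fin (nodeCount d)

embedNode : ∀ d → Bool → TreeNode d → TreeNode (suc d)
embedNode d s t = suc (half (nodeCount d) s t)

parentNode : ∀ d → Fin (innerNodeCount d) → TreeNode d
parentNode (suc d) j = lift (whichHalf (nodeCount d) j)
  where
  lift : Bool × TreeNode d → TreeNode (suc d)
  lift (s , zero)  = zero
  lift (s , suc i) = embedNode d s (parentNode d i)

parentNode-root : ∀ d s → parentNode (suc d) (half (nodeCount d) s zero) ≡ zero
parentNode-root d s rewrite whichHalf-half (nodeCount d) s zero = refl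

parentNode-embed : ∀ d s i → parentNode (suc d) (half (nodeCount d) s (suc i)) ≡ embedNode d s (parentNode d i)
parentNode-embed d s i rewrite whichHalf-half (nodeCount d) s (suc i) = refl

parentNode-≤ : ∀ d i → toℕ (parentNode d i) ≤ toℕ i
parentNode-≤ (suc d) j with halves (nodeCount d) j
... | halfOf s zero rewrite parentNode-root d s = z≤n
... | halfOf s (suc i)
  rewrite parentNode-embed d s i | toℕ-half (nodeCount d) s (parentNode d i) | toℕ-half (nodeCount d) s (suc i)
  = ≤-trans (s≤s (+-monoʳ-≤ (offset (nodeCount d) s) (parentNode-≤ d i))) (≤-reflexive (sym (+-suc _ (toℕ i))))

bagOf : ∀ d → V d → TreeNode d
bagOf zero    _             = zero
bagOf (suc d) zero          = zero
bagOf (suc d) (suc zero)    = zero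
bagOf (suc d) (suc (suc j)) = let (s , i) = whichHalf (size d) j in embedNode d s (bagOf d i)

bagOf-embed : ∀ d s i → bagOf (suc d) (embed d s i) ≡ embedNode d s (bagOf d i)
bagOf-embed d s i rewrite whichHalf-half (size d) s i = refl

bagOf-port₀ : ∀ d → bagOf d zero ≡ zero
bagOf-port₀ zero    = refl
bagOf-port₀ (suc d) = refl

bagOf-port₁ : ∀ d → bagOf d (suc zero) ≡ zero
bagOf-port₁ zero    = refl
bagOf-port₁ (suc d) = refl

decomposition : ∀ d → TreeCutDecomposition (graph d)
decomposition d = record { k = innerNodeCount d ; parent = parentNode d ; parent-lt = parentNode-≤ d ; bag = bagOf d }

embedNode-injective : ∀ d s s' t u → embedNode d s t ≡ embedNode d s' u → s ≡ s' × t ≡ u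
embedNode-injective d s s' t u eq with refl ← half-sides (nodeCount d) {s} {s'} t u (suc-injective eq) =
  refl , half-injective (nodeCount d) s (suc-injective eq)

module _ (d : ℕ) where
  private
    D : TreeCutDecomposition (graph d)
    D = decomposition d
    D′ : TreeCutDecomposition (graph (suc d))
    D′ = decomposition (suc d)
    module T  = TreeCut D
    module T′ = TreeCut D′

  Desc-embedNode : ∀ s {t u} → T.Desc t u → T′.Desc (embedNode d s t) (embedNode d s u)
  Desc-embedNode s T.here             = T′.here
  Desc-embedNode s (T.up {i} t⊑pi) =
    T′.up {i = half (nodeCount d) s (suc i)} (subst (T′.Desc _) (sym (parentNode-embed d s i)) (Desc-embedNode s t⊑pi))

  Desc-embedNode⁻ : ∀ {s t x} → T′.Desc (embedNode d s t) x → ∀ {s' u} → x ≡ embedNode d s' u → s' ≡ s × T.Desc t u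
  Desc-embedNode⁻ {s} {t} T′.here {s'} {u} x≡ with refl , refl ← embedNode-injective d s s' t u x≡ = refl , T.here
  Desc-embedNode⁻ (T′.up t⊑pj) {s'} {zero} x≡
    rewrite suc-injective x≡ | parentNode-root d s'
    with () ← T′.Desc-of-root t⊑pj
  Desc-embedNode⁻ {s} {t} (T′.up t⊑pj) {s'} {suc i} x≡
    rewrite suc-injective x≡ | parentNode-embed d s' i
    with refl , t⊑pi ← Desc-embedNode⁻ {s} {t} t⊑pj {s'} {parentNode d i} refl = refl , T.up t⊑pi

  inSubtree-embedNode⁻ : ∀ s s′ t u → inSubtree D′ (embedNode d s t) (embedNode d s′ u) ≡ true → s′ ≡ s × T.Desc t u
  inSubtree-embedNode⁻ s s′ t u inside =
    Desc-embedNode⁻ {s} {t} (T′.inSubtree⇒Desc (embedNode d s t) (embedNode d s′ u) inside) {s′} {u} refl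

  inSubtree-embedNode-same : ∀ s t u → inSubtree D′ (embedNode d s t) (embedNode d s u) ≡ inSubtree D t u
  inSubtree-embedNode-same s t u = true⇔true⇒≡
    (λ inside → T.Desc⇒inSubtree t u (proj₂ (inSubtree-embedNode⁻ s s t u inside)))
    (λ inside → T′.Desc⇒inSubtree (embedNode d s t) (embedNode d s u) (Desc-embedNode s (T.inSubtree⇒Desc t u inside)))

  inSubtree-embedNode-other : ∀ s t u → inSubtree D′ (embedNode d s t) (embedNode d (not s) u) ≡ false
  inSubtree-embedNode-other s t u =
    ¬-not λ inside → not-¬ refl (sym (proj₁ (inSubtree-embedNode⁻ s (not s) t u inside)))

  inSubtree-embedNode-root : ∀ s t → inSubtree D′ (embedNode d s t) zero ≡ false
  inSubtree-embedNode-root s t = ¬-not λ inside → case T′.Desc-of-root (T′.inSubtree⇒Desc (embedNode d s t) zero inside) of λ ()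

  inSubtree-embed-same : ∀ s t i → inSubtree D′ (embedNode d s t) (bagOf (suc d) (embed d s i)) ≡ inSubtree D t (bagOf d i)
  inSubtree-embed-same s t i = trans (cong (inSubtree D′ (embedNode d s t)) (bagOf-embed d s i)) (inSubtree-embedNode-same s t (bagOf d i))

  inSubtree-embed-other : ∀ s t i → inSubtree D′ (embedNode d s t) (bagOf (suc d) (embed d (not s) i)) ≡ false
  inSubtree-embed-other s t i = trans (cong (inSubtree D′ (embedNode d s t)) (bagOf-embed d (not s) i)) (inSubtree-embedNode-other s t (bagOf d i))

  crossing-embedNode : ∀ s t → T′.crossing (embedNode d s t) ≡ indicator (inSubtree D t zero) + (indicator (inSubtree D t zero) + T.crossing t)
  crossing-embedNode s t = trans (count-edges-suc d s (T′.crosses t′)) (trans (cong₂ _+_ own-copy other-copy) (+-identityʳ _))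
    where
    t′ : TreeNode (suc d)
    t′ = embedNode d s t
    port-crosses : ∀ q p → bagOf (suc d) q ≡ zero → bagOf d p ≡ zero → T′.crosses t′ (q , embed d s p) ≡ inSubtree D t zero
    port-crosses q p q-root p-root =
      cong₂ _xor_ (trans (cong (inSubtree D′ t′) q-root) (inSubtree-embedNode-root s t))
                  (trans (inSubtree-embed-same s t p) (cong (inSubtree D t) p-root))
    own-copy : count (T′.crosses t′) (copyEdges d s) ≡ indicator (inSubtree D t zero) + (indicator (inSubtree D t zero) + T.crossing t)
    own-copy = trans (count-copyEdges d s (T′.crosses t′))
      (cong₂ _+_ (cong indicator (port-crosses zero zero refl (bagOf-port₀ d)))
        (cong₂ _+_ (cong indicator (port-crosses (suc zero) (suc zero) refl (bagOf-port₁ d)))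
          (count-cong (λ { (u , w) → cong₂ _xor_ (inSubtree-embed-same s t u) (inSubtree-embed-same s t w) }) (edges d))))
    other-copy : count (T′.crosses t′) (copyEdges d (not s)) ≡ 0
    other-copy = trans (count-copyEdges d (not s) (T′.crosses t′))
      (cong₂ _+_ (cong indicator (cong₂ _xor_ (inSubtree-embedNode-root s t) (inSubtree-embed-other s t zero)))
        (cong₂ _+_ (cong indicator (cong₂ _xor_ (inSubtree-embedNode-root s t) (inSubtree-embed-other s t (suc zero))))
          (count-none (λ { (u , w) → cong₂ _xor_ (inSubtree-embed-other s t u) (inSubtree-embed-other s t w) }) (edges d))))

crossing≤2 : ∀ d t → TreeCut.crossing (decomposition d) t ≤ 2
crossing≤2 zero    zero    = ≤-trans (≤-reflexive (TreeCut.crossing-root (decomposition zero))) z≤n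
crossing≤2 (suc d) zero    = ≤-trans (≤-reflexive (TreeCut.crossing-root (decomposition (suc d)))) z≤n
crossing≤2 (suc d) (suc j) with halves (nodeCount d) j
... | halfOf s t rewrite crossing-embedNode d s t with inSubtree (decomposition d) t zero in t-above-root
...   | false = crossing≤2 d t
...   | true
  rewrite TreeCut.Desc-of-root (decomposition d) (TreeCut.inSubtree⇒Desc (decomposition d) t zero t-above-root)
        | TreeCut.crossing-root (decomposition d) = s≤s (s≤s z≤n)

bag-within-pair : ∀ d t → ∃[ a ] ∃[ b ] (∀ v → bagOf d v ≡ t → v ≡ a ⊎ v ≡ b)
bag-within-pair zero    zero    = zero , suc zero , λ { zero _ → inj₁ refl ; (suc zero) _ → inj₂ refl }
bag-within-pair (suc d) zero    = zero , suc zero , ports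
  where
  ports : ∀ v → bagOf (suc d) v ≡ zero → v ≡ zero ⊎ v ≡ suc zero
  ports v bag≡ with vertexView d v
  ... | port₀     = inj₁ refl
  ... | port₁     = inj₂ refl
  ... | inner s i with () ← trans (sym (bagOf-embed d s i)) bag≡
bag-within-pair (suc d) (suc j) with halves (nodeCount d) j
... | halfOf s t with a , b , within ← bag-within-pair d t = embed d s a , embed d s b , within′
  where
  within′ : ∀ v → bagOf (suc d) v ≡ embedNode d s t → v ≡ embed d s a ⊎ v ≡ embed d s b
  within′ v bag≡ with vertexView d v
  ... | port₀ with () ← bag≡
  ... | port₁ with () ← bag≡
  ... | inner s′ i with refl , bag≡′ ← embedNode-injective d s′ s (bagOf d i) t (trans (sym (bagOf-embed d s′ i)) bag≡) with within i bag≡′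
  ...   | inj₁ refl = inj₁ refl
  ...   | inj₂ refl = inj₂ refl

Unique-within-pair⇒length≤2 : ∀ {A : Set} (a b : A) (xs : List A) → Unique xs → All (λ x → x ≡ a ⊎ x ≡ b) xs → length xs ≤ 2
Unique-within-pair⇒length≤2 a b []               _ _ = z≤n
Unique-within-pair⇒length≤2 a b (x ∷ [])         _ _ = s≤s z≤n
Unique-within-pair⇒length≤2 a b (x ∷ y ∷ [])     _ _ = s≤s (s≤s z≤n)
Unique-within-pair⇒length≤2 a b (x ∷ y ∷ z ∷ xs) ((x≢y ∷ x≢z ∷ _) ∷ (y≢z ∷ _) ∷ _) (x∈ ∷ y∈ ∷ z∈ ∷ _) =
  ⊥-elim (pigeonhole x∈ y∈ z∈)
  where
  pigeonhole : x ≡ a ⊎ x ≡ b → y ≡ a ⊎ y ≡ b → z ≡ a ⊎ z ≡ b → ⊥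
  pigeonhole (inj₁ refl) (inj₁ refl) _           = x≢y refl
  pigeonhole (inj₂ refl) (inj₂ refl) _           = x≢y refl
  pigeonhole (inj₁ refl) (inj₂ refl) (inj₁ refl) = x≢z refl
  pigeonhole (inj₁ refl) (inj₂ refl) (inj₂ refl) = y≢z refl
  pigeonhole (inj₂ refl) (inj₁ refl) (inj₂ refl) = x≢z refl
  pigeonhole (inj₂ refl) (inj₁ refl) (inj₁ refl) = y≢z refl

bagSize≤2 : ∀ d t → TreeCut.bagSize (decomposition d) t ≤ 2
bagSize≤2 d t with a , b , within ← bag-within-pair d t =
  Unique-within-pair⇒length≤2 a b (filterᵇ (λ v → bagOf d v == t) (allFin (size d)))
    (Unique.filter⁺ (T? ∘ (λ v → bagOf d v == t)) (Unique.allFin⁺ (size d)))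
    (tabulate λ {v} v∈ → within v (==⇒≡ (Equivalence.to T-≡ (proj₂ (∈-filter⁻ (T? ∘ (λ v → bagOf d v == t)) v∈)))))

treeCutWidth≤2 : ∀ d → TreeCutWidthAtMost (graph d) 2
treeCutWidth≤2 d = decomposition d , TreeCut.width≤ (decomposition d) ≤-refl (bagSize≤2 d) (crossing≤2 d)

∈-copyEdges⇒∈-edges : ∀ d s {e} → e ∈ copyEdges d s → e ∈ edges (suc d)
∈-copyEdges⇒∈-edges d true  e∈ = ∈-++⁺ˡ e∈
∈-copyEdges⇒∈-edges d false e∈ = ∈-++⁺ʳ (copyEdges d true) e∈

port₀-edge∈ : ∀ d s → (zero , embed d s zero) ∈ edges (suc d)
port₀-edge∈ d s = ∈-copyEdges⇒∈-edges d s (here refl)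

port₁-edge∈ : ∀ d s → (suc zero , embed d s (suc zero)) ∈ edges (suc d)
port₁-edge∈ d s = ∈-copyEdges⇒∈-edges d s (there (here refl))

copy-edge∈ : ∀ d s {p q} → (p , q) ∈ edges d → (embed d s p , embed d s q) ∈ edges (suc d)
copy-edge∈ d s pq∈ = ∈-copyEdges⇒∈-edges d s (there (there (∈-map⁺ (mapEdge (embed d s)) pq∈)))

Adj-embed : ∀ d s {p q} → Adj (edges d) p q → Adj (edges (suc d)) (embed d s p) (embed d s q)
Adj-embed d s (inj₁ pq∈) = inj₁ (copy-edge∈ d s pq∈)
Adj-embed d s (inj₂ qp∈) = inj₂ (copy-edge∈ d s qp∈)

data EdgeView (d : ℕ) : Edge (size (suc d)) → Set where
  port₀-edge : ∀ s → EdgeView d (zero , embed d s zero)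
  port₁-edge : ∀ s → EdgeView d (suc zero , embed d s (suc zero))
  copy-edge  : ∀ s {p q} → (p , q) ∈ edges d → EdgeView d (embed d s p , embed d s q)

copyEdgeView : ∀ d s {e} → e ∈ copyEdges d s → EdgeView d e
copyEdgeView d s (here refl)         = port₀-edge s
copyEdgeView d s (there (here refl)) = port₁-edge s
copyEdgeView d s (there (there e∈)) with (p , q) , pq∈ , refl ← ∈-map⁻ (mapEdge (embed d s)) e∈ = copy-edge s pq∈

edgeView : ∀ d {e} → e ∈ edges (suc d) → EdgeView d e
edgeView d e∈ with ∈-++⁻ (copyEdges d true) e∈
... | inj₁ e∈true  = copyEdgeView d true e∈true
... | inj₂ e∈false = copyEdgeView d false e∈false

neighbour-port₀ : ∀ d {z} → Adj (edges (suc d)) zero z → ∃[ s ] (z ≡ embed d s zero)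
neighbour-port₀ d (inj₁ e∈) with edgeView d e∈
... | port₀-edge s = s , refl
neighbour-port₀ d (inj₂ e∈) with edgeView d e∈
... | ()

EmbedNeighbour : ∀ d → Bool → V d → V (suc d) → Set
EmbedNeighbour d s i y = (∃[ j ] (y ≡ embed d s j × Adj (edges d) i j)) ⊎ ((i ≡ zero × y ≡ zero) ⊎ (i ≡ suc zero × y ≡ suc zero))

neighbour-from : ∀ d s i {e} → EdgeView d e → proj₁ e ≡ embed d s i → EmbedNeighbour d s i (proj₂ e)
neighbour-from d s i (port₀-edge _) ()
neighbour-from d s i (port₁-edge _) ()
neighbour-from d s i (copy-edge s' {p} {q} pq∈) eq with refl , refl ← embed-injective₂ d s' s p i eq = inj₁ (q , refl , inj₁ pq∈)

neighbour-to : ∀ d s i {e} → EdgeView d e → proj₂ e ≡ embed d s i → EmbedNeighbour d s i (proj₁ e)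
neighbour-to d s i (port₀-edge s') eq with refl , refl ← embed-injective₂ d s' s zero i eq = inj₂ (inj₁ (refl , refl))
neighbour-to d s i (port₁-edge s') eq with refl , refl ← embed-injective₂ d s' s (suc zero) i eq = inj₂ (inj₂ (refl , refl))
neighbour-to d s i (copy-edge s' {p} {q} pq∈) eq with refl , refl ← embed-injective₂ d s' s q i eq = inj₁ (p , refl , inj₂ pq∈)

neighbour-embed : ∀ d s i {y} → Adj (edges (suc d)) (embed d s i) y → EmbedNeighbour d s i y
neighbour-embed d s i (inj₁ e∈) = neighbour-from d s i (edgeView d e∈) refl
neighbour-embed d s i (inj₂ e∈) = neighbour-to d s i (edgeView d e∈) refl

rest-in-copy : ∀ d s i rest → Unique (embed d s i ∷ rest) → zero ∉ rest → Linked (Adj (edges (suc d))) (embed d s i ∷ rest) →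
               last (embed d s i ∷ rest) ≡ just (suc zero) →
               ∃[ q ] (rest ≡ map (embed d s) q ++ [ suc zero ] × Linked (Adj (edges d)) (i ∷ q) × last (i ∷ q) ≡ just (suc zero))
rest-in-copy d s i []         _        _  _        lt with () ← Maybe.just-injective lt
rest-in-copy d s i (y ∷ rest) (_ ∷ u) 0∉ (r ∷ lk) lt with neighbour-embed d s i r
... | inj₁ (j , refl , ij) with q , refl , lk′ , lt′ ← rest-in-copy d s j rest u (0∉ ∘ there) lk lt = j ∷ q , refl , ij ∷ lk′ , lt′
... | inj₂ (inj₁ (_ , refl)) = ⊥-elim (0∉ (here refl))
rest-in-copy d s i (y ∷ [])        (_ ∷ u) 0∉ (r ∷ lk) lt | inj₂ (inj₂ (refl , refl)) = [] , refl , [-] , refl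
rest-in-copy d s i (y ∷ z ∷ rest) (_ ∷ u) 0∉ (r ∷ lk) lt | inj₂ (inj₂ (refl , refl)) =
  ⊥-elim (Unique-last≢head (suc zero) (z ∷ rest) u (λ ()) lt)

path-through-copy : ∀ d P → Unique P → IsWalk (Adj (edges (suc d))) zero (suc zero) P →
  ∃[ s ] ∃[ Q ] (P ≡ zero ∷ (map (embed d s) Q ++ [ suc zero ]) × Unique Q × IsWalk (Adj (edges d)) zero (suc zero) Q)
path-through-copy d (zero ∷ [])         _          (_ , refl , ())
path-through-copy d (zero ∷ z ∷ rest) (0∉ ∷ u) (r ∷ lk , refl , lt)
  with s , refl ← neighbour-port₀ d r
  with q , refl , lk′ , lt′ ← rest-in-copy d s zero rest u (λ 0∈ → lookup 0∉ (there 0∈) refl) lk lt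
  = s , zero ∷ q , refl , Unique.map⁻ (Unique-++⁻ˡ (map (embed d s) (zero ∷ q)) [ suc zero ] u) , lk′ , refl , lt′

path-in-G₀ : ∀ P → Unique P → IsWalk (Adj (edges zero)) zero (suc zero) P → P ≡ zero ∷ suc zero ∷ []
path-in-G₀ (zero ∷ [])                      _                     (_ , refl , ())
path-in-G₀ (zero ∷ zero ∷ _)                ((0≢0 ∷ _) ∷ _)       (_ , refl , _) = ⊥-elim (0≢0 refl)
path-in-G₀ (zero ∷ suc zero ∷ [])           _                     _              = refl
path-in-G₀ (zero ∷ suc zero ∷ zero ∷ _)     ((_ ∷ 0≢0 ∷ _) ∷ _)   (_ , refl , _) = ⊥-elim (0≢0 refl)
path-in-G₀ (zero ∷ suc zero ∷ suc zero ∷ _) (_ ∷ (1≢1 ∷ _) ∷ _)   (_ , refl , _) = ⊥-elim (1≢1 refl)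

port-walk : ∀ d → ∃[ l ] IsWalk (Adj (edges d)) zero (suc zero) l
port-walk zero    = zero ∷ suc zero ∷ [] , inj₁ (here refl) ∷ [-] , refl , refl
port-walk (suc d) with zero ∷ l , lk , refl , lt ← port-walk d =
  zero ∷ (map (embed d true) (zero ∷ l) ++ [ suc zero ]) ,
  inj₁ (port₀-edge∈ d true) ∷ Linked-snoc⁺ (map (embed d true) (zero ∷ l)) (suc zero)
                                (Linked.map⁺ (Linked.map (Adj-embed d true) lk)) (last-map (embed d true) (zero ∷ l) lt)
                                (inj₂ (port₁-edge∈ d true)) ,
  refl ,
  last-snoc (embed d true zero ∷ map (embed d true) l) (suc zero)

OnSide : ∀ d → Bool → V (suc d) → Set
OnSide d s x = ∃[ j ] (x ≡ embed d s j)

OnSide-disjoint : ∀ d s {x} → OnSide d s x → OnSide d (not s) x → ⊥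
OnSide-disjoint d s (i , refl) (j , eq) = embed-disjoint d s i j eq

Outside : ∀ d → Bool → V (suc d) → Set
Outside d s x = ∀ j → x ≢ embed d s j

OnOtherSide⇒Outside : ∀ d s {x} → OnSide d (not s) x → Outside d s x
OnOtherSide⇒Outside d s other j refl = OnSide-disjoint d s (j , refl) other

OtherSideStep : ∀ d → Bool → V (suc d) → V (suc d) → Set
OtherSideStep d s x y = Adj (edges (suc d)) x y × (OnSide d (not s) x ⊎ OnSide d (not s) y)

detour : ∀ d s → ∃[ W ] IsWalk (OtherSideStep d s) zero (suc zero) W
detour d s with zero ∷ l , lk , refl , lt ← port-walk d =
  zero ∷ (map (embed d (not s)) (zero ∷ l) ++ [ suc zero ]) ,
  (inj₁ (port₀-edge∈ d (not s)) , inj₂ (zero , refl)) ∷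
    Linked-snoc⁺ (map (embed d (not s)) (zero ∷ l)) (suc zero)
      (Linked.map⁺ (Linked.map (λ {p} pq → Adj-embed d (not s) pq , inj₁ (p , refl)) lk))
      (last-map (embed d (not s)) (zero ∷ l) lt)
      (inj₂ (port₁-edge∈ d (not s)) , inj₁ (suc zero , refl)) ,
  refl ,
  last-snoc (map (embed d (not s)) (zero ∷ l)) (suc zero)

module EdgeCutWidth (m : ℕ) (F : List (Edge (size m))) (msf : IsMaximalSpanningForest (graph m) F) where

  acyclic : Acyclic F
  acyclic = proj₁ (proj₂ (proj₂ msf))

  Adj-F⇒G : ∀ {x y} → Adj F x y → Adj (edges m) x y
  Adj-F⇒G (inj₁ xy∈) = inj₁ (lookup (proj₁ msf) xy∈)
  Adj-F⇒G (inj₂ yx∈) = inj₂ (lookup (proj₁ msf) yx∈)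

  Adj-G⇒Star : ∀ {x y} → Adj (edges m) x y → Star (Adj F) x y
  Adj-G⇒Star (inj₁ xy∈) = MaximalSpanningForest-connects (graph m) F msf xy∈
  Adj-G⇒Star (inj₂ yx∈) = Adj-reverse (MaximalSpanningForest-connects (graph m) F msf yx∈)

  Adj-G-irreflexive : ∀ {x y} → Adj (edges m) x y → x ≢ y
  Adj-G-irreflexive (inj₁ xy∈) refl = <-irrefl refl (lookup (edges-ordered m) xy∈)
  Adj-G-irreflexive (inj₂ yx∈) refl = <-irrefl refl (lookup (edges-ordered m) yx∈)

  -- a non-tree edge of G leaving the part of F ∖ ab around a closes a cycle through ab, hence through a
  leaving-edge-feedback : ∀ {a b x y} → Adj F a b → Adj (edges m) x y → ¬ ((x ≡ a × y ≡ b) ⊎ (x ≡ b × y ≡ a)) →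
    Star (Adj (removeEdge F a b)) a x → ¬ Star (Adj (removeEdge F a b)) a y →
    ∃[ e ] (InLocalFeedback (graph m) F a e × (e ≡ (x , y) ⊎ e ≡ (y , x)))
  leaving-edge-feedback {a} {b} {x} {y} ab xy xy≢ab a↝x ¬a↝y = go xy
    where
    a≢b : a ≢ b
    a≢b = Adj-G-irreflexive (Adj-F⇒G ab)
    ¬Adj-F : ¬ Adj F x y
    ¬Adj-F xy∈F = ¬a↝y (a↝x ◅◅ (Adj-removeEdge⁺ xy∈F xy≢ab ◅ ε))
    b↝y : Star (Adj (removeEdge F a b)) b y
    b↝y with removeEdge-split acyclic ab a≢b (Star.map Adj-removeEdge⁻ a↝x ◅◅ Adj-G⇒Star xy)
    ... | inj₁ a↝y = ⊥-elim (¬a↝y a↝y)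
    ... | inj₂ b↝y = b↝y
    go : Adj (edges m) x y → ∃[ e ] (InLocalFeedback (graph m) F a e × (e ≡ (x , y) ⊎ e ≡ (y , x)))
    go (inj₁ xy∈) with p , path , a∈ , _ ← join-at-edge ab (removeEdge-separates acyclic ab a≢b) (Adj-reverse a↝x) b↝y =
      (x , y) , (xy∈ , ¬Adj-F ∘ inj₁ , p , path , a∈) , inj₁ refl
    go (inj₂ yx∈)
      with p , path , _ , a∈ ← join-at-edge (Adj-sym ab) (removeEdge-separates acyclic ab a≢b ∘ Adj-reverse) (Adj-reverse b↝y) a↝x =
      (y , x) , (yx∈ , ¬Adj-F ∘ inj₂ , p , path , a∈) , inj₂ refl

  IsCopy : ∀ d → (V d → V m) → Set
  IsCopy d emb = (∀ {x y} → emb x ≡ emb y → x ≡ y) × (∀ {x y} → Adj (edges d) x y → Adj (edges m) (emb x) (emb y))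

  IsCopy-embed : ∀ d s {emb} → IsCopy (suc d) emb → IsCopy d (emb ∘ embed d s)
  IsCopy-embed d s (injective , edge) = embed-injective d s ∘ injective , edge ∘ Adj-embed d s

  InsideCopy : ∀ d → (V d → V m) → Edge (size m) → Set
  InsideCopy d emb e = ∃[ x ] ∃[ y ] (e ≡ (emb x , emb y))

  -- the invariant of the induction over the nesting depth of the copies of G_d met by the F-path from 0 to 1
  record SeparatingEdge (d : ℕ) (emb : V d → V m) : Set where
    field
      a b             : V m
      ab              : Adj F a b
      a-inside        : ∃[ x ] (emb x ≡ a)
      b-inside        : ∃[ x ] (emb x ≡ b)
      a↝port₀         : Star (Adj (removeEdge F a b)) a (emb zero)
      b↝port₁         : Star (Adj (removeEdge F a b)) b (emb (suc zero))
      feedback        : List (Edge (size m))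
      feedback-unique : Unique feedback
      feedback-local  : All (InLocalFeedback (graph m) F a) feedback
      feedback-inside : All (InsideCopy d emb) feedback
      depth≤length    : d ≤ length feedback

  separating-base : ∀ emb → Adj F (emb zero) (emb (suc zero)) → SeparatingEdge zero emb
  separating-base emb ab = record
    { a = emb zero ; b = emb (suc zero) ; ab = ab ; a-inside = zero , refl ; b-inside = suc zero , refl
    ; a↝port₀ = ε ; b↝port₁ = ε
    ; feedback = [] ; feedback-unique = [] ; feedback-local = [] ; feedback-inside = [] ; depth≤length = z≤n }

  separating-step : ∀ d s emb → IsCopy (suc d) emb →
    Adj F (emb zero) (emb (embed d s zero)) → Adj F (emb (embed d s (suc zero))) (emb (suc zero)) →
    SeparatingEdge d (emb ∘ embed d s) → SeparatingEdge (suc d) emb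
  separating-step d s emb (injective , edge) first last R = record
    { a = a ; b = b ; ab = ab
    ; a-inside = embed d s (proj₁ a-inside) , proj₂ a-inside
    ; b-inside = embed d s (proj₁ b-inside) , proj₂ b-inside
    ; a↝port₀ = a↝port₀′
    ; b↝port₁ = b↝port₁′
    ; feedback = proj₁ new ∷ feedback
    ; feedback-unique = tabulate fresh ∷ feedback-unique
    ; feedback-local = proj₁ (proj₂ new) ∷ feedback-local
    ; feedback-inside = new-inside (proj₂ (proj₂ new)) ∷ All.map lift feedback-inside
    ; depth≤length = s≤s depth≤length }
    where
    open SeparatingEdge R
    F∖ab : List (Edge (size m))
    F∖ab = removeEdge F a b

    ≢-inside : ∀ {x} → Outside d s x → ∀ {v} → ∃[ j ] (emb (embed d s j) ≡ v) → emb x ≢ v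
    ≢-inside outside (j , refl) eq = outside j (injective eq)

    not-ab : ∀ {x y} → Outside d s x ⊎ Outside d s y → ¬ ((emb x ≡ a × emb y ≡ b) ⊎ (emb x ≡ b × emb y ≡ a))
    not-ab (inj₁ out) (inj₁ (x≡a , _)) = ≢-inside out a-inside x≡a
    not-ab (inj₁ out) (inj₂ (x≡b , _)) = ≢-inside out b-inside x≡b
    not-ab (inj₂ out) (inj₁ (_ , y≡b)) = ≢-inside out b-inside y≡b
    not-ab (inj₂ out) (inj₂ (_ , y≡a)) = ≢-inside out a-inside y≡a

    a↝port₀′ : Star (Adj F∖ab) a (emb zero)
    a↝port₀′ = a↝port₀ ◅◅ (Adj-removeEdge⁺ (Adj-sym first) (not-ab (inj₂ λ _ ())) ◅ ε)

    b↝port₁′ : Star (Adj F∖ab) b (emb (suc zero))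
    b↝port₁′ = b↝port₁ ◅◅ (Adj-removeEdge⁺ last (not-ab (inj₂ λ _ ())) ◅ ε)

    ¬a↝port₁ : ¬ Star (Adj F∖ab) a (emb (suc zero))
    ¬a↝port₁ a↝port₁ = removeEdge-separates acyclic ab (Adj-G-irreflexive (Adj-F⇒G ab)) (a↝port₁ ◅◅ Adj-reverse b↝port₁′)

    leaving : ∃[ x ] ∃[ y ] (OtherSideStep d s x y × Star (Adj F∖ab) a (emb x) × ¬ Star (Adj F∖ab) a (emb y))
    leaving = walk-leaves (λ z → Star (Adj F∖ab) a (emb z)) (λ z → Star? (Adj? F∖ab) a (emb z))
                          (proj₁ (detour d s)) (proj₂ (detour d s)) a↝port₀′ ¬a↝port₁

    x y : V (suc d)
    x = proj₁ leaving
    y = proj₁ (proj₂ leaving)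

    other-side : OnSide d (not s) x ⊎ OnSide d (not s) y
    other-side = proj₂ (proj₁ (proj₂ (proj₂ leaving)))

    new : ∃[ e ] (InLocalFeedback (graph m) F a e × (e ≡ (emb x , emb y) ⊎ e ≡ (emb y , emb x)))
    new with _ , _ , (xy , other) , a↝x , ¬a↝y ← leaving =
      leaving-edge-feedback ab (edge xy) (not-ab (Sum.map (OnOtherSide⇒Outside d s) (OnOtherSide⇒Outside d s) other)) a↝x ¬a↝y

    new-inside : ∀ {e} → e ≡ (emb x , emb y) ⊎ e ≡ (emb y , emb x) → InsideCopy (suc d) emb e
    new-inside (inj₁ refl) = x , y , refl
    new-inside (inj₂ refl) = y , x , refl

    lift : ∀ {e} → InsideCopy d (emb ∘ embed d s) e → InsideCopy (suc d) emb e
    lift (x′ , y′ , eq) = embed d s x′ , embed d s y′ , eq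

    both-inside : ∀ {i j} → x ≡ embed d s i → y ≡ embed d s j → ⊥
    both-inside x≡ y≡ = [ OnSide-disjoint d s (_ , x≡) , OnSide-disjoint d s (_ , y≡) ]′ other-side

    distinct : ∀ {e e′} → e ≡ (emb x , emb y) ⊎ e ≡ (emb y , emb x) → InsideCopy d (emb ∘ embed d s) e′ → e ≢ e′
    distinct (inj₁ refl) (_ , _ , refl) eq = both-inside (injective (cong proj₁ eq)) (injective (cong proj₂ eq))
    distinct (inj₂ refl) (_ , _ , refl) eq = both-inside (injective (cong proj₂ eq)) (injective (cong proj₁ eq))

    fresh : ∀ {e} → e ∈ feedback → proj₁ new ≢ e
    fresh e∈ = distinct (proj₂ (proj₂ new)) (lookup feedback-inside e∈)

  separating : ∀ d emb → IsCopy d emb → ∀ P → Unique P → IsWalk (Adj (edges d)) zero (suc zero) P →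
               Linked (λ x y → Adj F (emb x) (emb y)) P → SeparatingEdge d emb
  separating zero emb copy P uniq walk lk with refl ← path-in-G₀ P uniq walk with ab ∷ _ ← lk = separating-base emb ab
  separating (suc d) emb copy P uniq walk lk
    with s , Q , refl , uniqQ , walkQ@(_ , hd , lt) ← path-through-copy d P uniq walk
    with first , middle , last ← Linked-bracket⁻ (embed d s) Q hd lt lk
    = separating-step d s emb copy first last (separating d (emb ∘ embed d s) (IsCopy-embed d s copy) Q uniqQ walkQ middle)

  port-path : ∃[ P ] (Unique P × IsWalk (Adj F) zero (suc zero) P)
  port-path = let (l , walk) = port-walk m in Star⇒path Fin._≟_ (kleisliStar id Adj-G⇒Star (walk⇒Star l walk))

edgeCutWidth≥ : ∀ m → EdgeCutWidthAtLeast (graph m) (suc m)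
edgeCutWidth≥ m F msf with P , uniq , lk , hd , lt ← EdgeCutWidth.port-path m F msf =
  a , feedback , feedback-unique , feedback-local , s≤s depth≤length
  where
  open EdgeCutWidth m F msf
  open SeparatingEdge (separating m id (id , id) P uniq (Linked.map Adj-F⇒G lk , hd , lt) lk)

lemma2 : ∀ (m : ℕ) → ∃[ G ] (MaxDegreeAtMost 3 G × TreeCutWidthAtMost G 2 × EdgeCutWidthAtLeast G (suc m))
lemma2 m = graph m , maxDegree≤3 m , treeCutWidth≤2 m , edgeCutWidth≥ m
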